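{- Let $\lambda$ be a joint labeling of unlabeled forests $\mathsf{F},\mathsf{G}$, each of height at most $h$, and let $\hat{\lambda} = \mathsf{L}(\lambda,h)$. Then there exists a tree alignment $\mathcal{A} \in \mathsf{TA}(\mathsf{F},\mathsf{G})$ of optimum cost, i.e., $\mathsf{ted}_{\lambda,\mathcal{A}}(\mathsf{F},\mathsf{G})=\min_{\mathcal{B}\in\mathsf{TA}(\mathsf{F},\mathsf{G})}\mathsf{ted}_{\lambda,\mathcal{B}}(\mathsf{F},\mathsf{G})$, such that $\mathcal{A}$ is a greedy alignment of the strings $P_{\hat{\lambda}}(\mathsf{F})$ and $P_{\hat{\lambda}}(\mathsf{G})$.
   Context: Forests: a forest is a possibly empty sequence of non-empty rooted ordered trees. $\mathsf{F},\mathsf{G}$ have disjoint node sets $V_\mathsf{F},V_\mathsf{G}$, and a joint labeling is a map $\lambda:V_\mathsf{F}\cup V_\mathsf{G}\to\Sigma$ for an integer alphabet $\Sigma$. Height of a forest: maximum number of nodes on a root-to-leaf path. Parentheses representation: if $\mathsf{F}$ consists of trees $T_1,\dots,T_m$ where $T_i$ has root $v_i$ and $\mathsf{F}_i$ is the forest of descendants of $v_i$, then $P_\lambda(\mathsf{F})=\bigodot_{i=1}^m \big(\texttt{(}_{\lambda(v_i)}\cdot P_\lambda(\mathsf{F}_i)\cdot \texttt{)}_{\lambda(v_i)}\big)$, a string over $\{\texttt{(},\texttt{)}\}\times\Sigma$; $P(\mathsf{F})$ denotes the same string with labels dropped. For $u\in V_\mathsf{F}$, $o_\mathsf{F}(u)$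 and $c_\mathsf{F}(u)$ are the (0-indexed) positions of the opening and closing parenthesis of $u$. String alignments: an alignment of $X$ onto $Y$ is a sequence $\mathcal{A}=(x_t,y_t)_{t=0}^m$ with $(x_0,y_0)=(0,0)$, $(x_m,y_m)=(|X|,|Y|)$ and $(x_{t+1},y_{t+1})-(x_t,y_t)\in\{(1,1),(1,0),(0,1)\}$. A step $(1,0)$ deletes $X[x_t]$, a step $(0,1)$ inserts $Y[y_t]$, a step $(1,1)$ aligns $X[x_t]$ with $Y[y_t]$ (a match if $X[x_t]=Y[y_t]$, a substitution otherwise). The cost $\mathsf{ed}_\mathcal{A}(X,Y)$ is the number of deletions, insertions and substitutions. An element $(x_t,y_t)$ is a match if $t<m$, the step $t\to t+1$ is $(1,1)$ and $X[x_t]=Y[y_t]$; all other elements are breakpoints. $\mathcal{A}$ is greedy if $X[x]\ne Y[y]$ for every breakpoint $(x,y)$ with $x\ne|X|$ and $y\ne|Y|$. Tree alignments: $\mathcal{A}$ is a tree alignment of $\mathsf{F},\mathsf{G}$ (written $\mathcal{A}\in\mathsf{TA}(\mathsf{F},\mathsf{G})$) if it is an alignment of $P(\mathsf{F})$ onto $P(\mathsf{G})$ such that for every $u\in V_\mathsf{F}$ either $\mathcal{A}$ deletes both $P(\mathsf{F})[o_\mathsf{F}(u)]$ and $P(\mathsf{F})[c_\mathsf{F}(u)]$, or there is $v\in V_\mathsf{G}$ with $P(\mathsf{F})[o_\mathsf{F}(u)]$ aligned with $P(\mathsf{G})[o_\mathsf{G}(v)]$ and $P(\mathsf{F})[c_\mathsf{F}(u)]$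 aligned with $P(\mathsf{G})[c_\mathsf{G}(v)]$. Its cost under $\lambda$ is $\mathsf{ted}_{\lambda,\mathcal{A}}(\mathsf{F},\mathsf{G})=\tfrac12\mathsf{ed}_\mathcal{A}(P_\lambda(\mathsf{F}),P_\lambda(\mathsf{G}))$ (a tree alignment of $\mathsf{F},\mathsf{G}$ is also an alignment of the labeled strings, since positions coincide). Look-ahead refinement: for $v$ a node, $\mathsf{sub}_{<d}(v)$ is the subtree rooted at $v$ restricted to nodes at distance less than $d$ from $v$. $\mathsf{L}(\lambda,d)$ denotes any labeling $\lambda'$ of $V_\mathsf{F}\cup V_\mathsf{G}$ such that $\lambda'(u)=\lambda'(v)$ iff $P_\lambda(\mathsf{sub}_{<d}(u))=P_\lambda(\mathsf{sub}_{<d}(v))$. -}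

module Defs where

open import Data.Bool using (Bool; true; false)
open import Data.Nat using (ℕ; zero; suc; _+_; _*_; _⊔_)
open import Data.Integer using (+_)
open import Data.Rational.Unnormalised using (ℚᵘ; _/_)
open import Data.List using (List; []; _∷_; _++_; length)
open import Data.List.Membership.Propositional using (_∈_)
open import Data.Maybe using (Maybe; just; nothing)
open import Data.Product using (Σ; ∃; _×_; _,_)
open import Data.Sum using (_⊎_; inj₁; inj₂)
open import Function using (_∘_)
open import Function.Bundles using (_⇔_)
open import Relation.Binary.PropositionalEquality using (_≡_; _≢_)
open import Relation.Binary.Definitions using (DecidableEquality)
open import Relation.Nullary using (¬_; yes; no)
import Data.Bool.Properties as BoolP
import Data.Nat.Properties as NatP
import Data.Product.Properties as ProdP
import Data.Maybe.Properties as MaybeP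

data Tree : Set where
  node : List Tree → Tree

Forest : Set
Forest = List Tree

-- Nodes of a forest (node identities = addresses in the forest)
data Node : Forest → Set where
  root  : ∀ {cs ts} → Node (node cs ∷ ts)
  below : ∀ {cs ts} → Node cs → Node (node cs ∷ ts)
  there : ∀ {t ts} → Node ts → Node (t ∷ ts)

size : Forest → ℕ
size [] = 0
size (node cs ∷ ts) = suc (size cs + size ts)

-- height: maximum number of nodes on a root-to-leaf path (0 for empty)
height : Forest → ℕ
height [] = 0
height (node cs ∷ ts) = suc (height cs) ⊔ height ts

-- Parentheses representations.  A parenthesis is (true = '(' , false = ')').

Sym : Set
Sym = Bool × ℕ

_≟Sym_ : DecidableEquality Sym
_≟Sym_ = ProdP.≡-dec BoolP._≟_ NatP._≟_

Pl : (fs : Forest) → (Node fs → ℕ) → List Sym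
Pl [] ℓ = []
Pl (node cs ∷ ts) ℓ =
  (true , ℓ root) ∷ Pl cs (ℓ ∘ below) ++ (false , ℓ root) ∷ Pl ts (ℓ ∘ there)

P : Forest → List Bool
P [] = []
P (node cs ∷ ts) = true ∷ P cs ++ false ∷ P ts

-- o_F(u), c_F(u): 0-indexed positions of the opening/closing parenthesis of u
o : ∀ {fs} → Node fs → ℕ
o root = 0
o (below q) = suc (o q)
o (there {t} q) = 2 * size (t ∷ []) + o q

c : ∀ {fs} → Node fs → ℕ
c (root {cs}) = suc (2 * size cs)
c (below q) = suc (c q)
c (there {t} q) = 2 * size (t ∷ []) + c q

-- P_λ of the forest restricted to nodes of depth < d (roots have depth 0)
PlTrunc : ℕ → (fs : Forest) → (Node fs → ℕ) → List Sym
PlTrunc zero fs ℓ = []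
PlTrunc (suc d) [] ℓ = []
PlTrunc (suc d) (node cs ∷ ts) ℓ =
  (true , ℓ root) ∷ PlTrunc d cs (ℓ ∘ below) ++ (false , ℓ root) ∷ PlTrunc (suc d) ts (ℓ ∘ there)

-- P_λ(sub_{<d}(v)) : subtree rooted at v restricted to nodes at distance < d from v
PlSub : ℕ → (fs : Forest) → (Node fs → ℕ) → Node fs → List Sym
PlSub zero (node cs ∷ ts) ℓ root = []
PlSub (suc d) (node cs ∷ ts) ℓ root =
  (true , ℓ root) ∷ PlTrunc d cs (ℓ ∘ below) ++ (false , ℓ root) ∷ []
PlSub d (node cs ∷ ts) ℓ (below q) = PlSub d cs (ℓ ∘ below) q
PlSub d (t ∷ ts) ℓ (there q) = PlSub d ts (ℓ ∘ there) q

Labeling : Forest → Forest → Set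
Labeling F G = Node F ⊎ Node G → ℕ

PlF : ∀ F G → Labeling F G → List Sym
PlF F G lab = Pl F (lab ∘ inj₁)

PlG : ∀ F G → Labeling F G → List Sym
PlG F G lab = Pl G (lab ∘ inj₂)

subJ : ∀ F G → Labeling F G → ℕ → Node F ⊎ Node G → List Sym
subJ F G lab d (inj₁ u) = PlSub d F (lab ∘ inj₁) u
subJ F G lab d (inj₂ v) = PlSub d G (lab ∘ inj₂) v

-- lab' is a valid choice of L(lab, d)
IsLookAhead : ∀ F G → Labeling F G → ℕ → Labeling F G → Set
IsLookAhead F G lab d lab' =
  ∀ u v → (lab' u ≡ lab' v) ⇔ (subJ F G lab d u ≡ subJ F G lab d v)

-- String alignments, given by their sequence of steps:
-- D = (1,0) deletion, I = (0,1) insertion, M = (1,1) diagonal.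
-- The points (x_t,y_t) are the prefix sums starting at (0,0).

data Step : Set where
  D I M : Step

dx dy : Step → ℕ
dx D = 1
dx I = 0
dx M = 1
dy D = 0
dy I = 1
dy M = 1

sumX sumY : List Step → ℕ
sumX [] = 0
sumX (s ∷ ss) = dx s + sumX ss
sumY [] = 0
sumY (s ∷ ss) = dy s + sumY ss

-- (x_t, y_t, step t→t+1), with nothing for the last element t = m
trace : ℕ → ℕ → List Step → List (ℕ × ℕ × Maybe Step)
trace x y [] = (x , y , nothing) ∷ []
trace x y (s ∷ ss) = (x , y , just s) ∷ trace (x + dx s) (y + dy s) ss

Elements : List Step → List (ℕ × ℕ × Maybe Step)
Elements = trace 0 0

IsAlignment : ∀ {S T : Set} → List S → List T → List Step → Set
IsAlignment X Y A = sumX A ≡ length X × sumY A ≡ length Y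

_!_ : ∀ {S : Set} → List S → ℕ → Maybe S
[] ! n = nothing
(a ∷ as) ! zero = just a
(a ∷ as) ! suc n = as ! n

Deletes : List Step → ℕ → Set
Deletes A x = ∃ λ y → (x , y , just D) ∈ Elements A

AlignsWith : List Step → ℕ → ℕ → Set
AlignsWith A x y = (x , y , just M) ∈ Elements A

module _ {S : Set} (_≟_ : DecidableEquality S) where
  elemCost : List S → List S → ℕ × ℕ × Maybe Step → ℕ
  elemCost X Y (x , y , nothing) = 0
  elemCost X Y (x , y , just D) = 1
  elemCost X Y (x , y , just I) = 1
  elemCost X Y (x , y , just M) with MaybeP.≡-dec _≟_ (X ! x) (Y ! y)
  ... | yes _ = 0
  ... | no _ = 1

  costList : List S → List S → List (ℕ × ℕ × Maybe Step) → ℕ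
  costList X Y [] = 0
  costList X Y (e ∷ es) = elemCost X Y e + costList X Y es

  ed : List S → List S → List Step → ℕ
  ed X Y A = costList X Y (Elements A)

IsMatch : ∀ {S : Set} → List S → List S → ℕ → ℕ → Maybe Step → Set
IsMatch X Y x y ms = ms ≡ just M × X ! x ≡ Y ! y

Greedy : ∀ {S : Set} → List S → List S → List Step → Set
Greedy X Y A = ∀ x y ms → (x , y , ms) ∈ Elements A → ¬ IsMatch X Y x y ms →
  x ≢ length X → y ≢ length Y → X ! x ≢ Y ! y

IsTreeAlignment : Forest → Forest → List Step → Set
IsTreeAlignment F G A =
  IsAlignment (P F) (P G) A ×
  (∀ (u : Node F) →
     (Deletes A (o u) × Deletes A (c u)) ⊎
     (∃ λ (v : Node G) → AlignsWith A (o u) (o v) × AlignsWith A (c u) (c v)))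

ted : ∀ F G → Labeling F G → List Step → ℚᵘ
ted F G lab A = (+ ed _≟Sym_ (PlF F G lab) (PlG F G lab) A) / 2

-- Take a tree alignment that is minimal for the lexicographic order on (cost under λ, cost under λ̂,
-- indel pattern, where a match is preferred to an indel as early as possible); it is optimal, and we
-- show it is greedy for λ̂.  Suppose it has a breakpoint (x, y) with equal λ̂-symbols.  They are the
-- opening or the closing parentheses of nodes u, v with λ̂(u) = λ̂(v), and since the forests have
-- height at most h this means that the subtrees of u and v coincide, labels under λ included.  So
-- the blocks [o u, c u] and [o v, c v] agree symbol by symbol under λ and under λ̂, and splicing the
-- diagonal through them (keeping the alignment before the blocks and restricting the part after
-- them) gives a tree alignment that costs no more under either labeling.  At an opening pair the
-- splice puts a match where the alignment had an indel, so it comes earlier in the indel pattern.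
-- At a closing pair where, say, X[c u] is deleted, the splice saves that deletion under λ̂, because
-- the remainder never aligns Y[c v] with an equal symbol: such an X[c a] with c a > c u would make
-- a, which has the same λ̂-label and hence the same subtree as u, strictly contain u.

module Submission where

open import Defs

open import Data.Bool using (Bool; true; false)
import Data.Bool as Bool
import Data.Bool.Properties as BoolP
open import Data.Empty using (⊥; ⊥-elim)
import Data.Integer as ℤ
import Data.Integer.Properties as ℤP
open import Data.List using (List; []; _∷_; _++_; length; map; replicate)
open import Data.List.Properties using (length-++; length-map; ++-assoc; map-++; ∷-injectiveˡ; ∷-injectiveʳ)
open import Data.List.Membership.Propositional using (_∈_; find; lose)
open import Data.List.Membership.Propositional.Properties using (∈-map⁺; ∈-++⁺ˡ; ∈-++⁺ʳ)
open import Data.List.Relation.Binary.Lex.Strict using (Lex-<; this; next)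
  renaming (<-isStrictPartialOrder to Lex-<-isStrictPartialOrder; <-decidable to Lex-<-decidable)
open import Data.List.Relation.Unary.All as All using (all?)
open import Data.List.Relation.Unary.Any using (Any; here; there; any?; satisfied)
open import Data.Maybe using (Maybe; just; nothing)
open import Data.Maybe.Properties using (just-injective)
import Data.Maybe.Properties as MaybeP
open import Data.Nat hiding (_!; _/_)
open import Data.Nat.Properties
open import Data.Nat.Tactic.RingSolver using (solve-∀)
open import Data.Product using (Σ; ∃; _×_; _,_; proj₁; proj₂; map₁; map₂) renaming (map to map×)
open import Data.Product.Properties using (,-injective) renaming (≡-dec to ×-≡-dec)
open import Data.Product.Relation.Binary.Lex.Strict using (×-Lex; ×-isStrictPartialOrder; ×-decidable)
open import Data.Rational.Unnormalised using (_/_; *≤*)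
import Data.Rational.Unnormalised as Q
open import Data.Sum using (_⊎_; inj₁; inj₂) renaming (map to map⊎)
open import Function using (_∘_)
open import Function.Bundles using (Equivalence)
open import Relation.Binary.Definitions using (DecidableEquality; tri<; tri≈; tri>)
open import Relation.Binary.PropositionalEquality
open import Relation.Binary.Structures using (IsStrictPartialOrder)
open import Relation.Nullary using (¬_; yes; no; Dec)
open import Relation.Nullary.Decidable using (_×-dec_; _⊎-dec_; map′)

open ≡-Reasoning

-- Parenthesis strings

!-++ˡ : ∀ {S : Set} (xs ys : List S) {n} → n < length xs → (xs ++ ys) ! n ≡ xs ! n
!-++ˡ (x ∷ xs) ys {zero} _ = refl
!-++ˡ (x ∷ xs) ys {suc n} (s≤s n<) = !-++ˡ xs ys n<

!-++ʳ : ∀ {S : Set} (xs ys : List S) {m} n → length xs ≡ m → (xs ++ ys) ! (m + n) ≡ ys ! n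
!-++ʳ [] ys n refl = refl
!-++ʳ (x ∷ xs) ys n refl = !-++ʳ xs ys n refl

!≡just⇒< : ∀ {S : Set} (xs : List S) n {x} → xs ! n ≡ just x → n < length xs
!≡just⇒< (y ∷ xs) zero _ = s≤s z≤n
!≡just⇒< (y ∷ xs) (suc n) e = s≤s (!≡just⇒< xs n e)

<⇒!≡just : ∀ {S : Set} (xs : List S) n → n < length xs → ∃ λ x → xs ! n ≡ just x
<⇒!≡just (x ∷ xs) zero _ = x , refl
<⇒!≡just (x ∷ xs) (suc n) (s≤s n<) = <⇒!≡just xs n n<

2*size-∷ : ∀ cs ts → 2 * size (node cs ∷ ts) ≡ suc (suc (2 * size cs)) + 2 * size ts
2*size-∷ cs ts = arith (size cs) (size ts)
  where
  arith : ∀ a b → 2 * suc (a + b) ≡ suc (suc (2 * a)) + 2 * b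
  arith = solve-∀

2*size-singleton : ∀ cs → 2 * size (node cs ∷ []) ≡ suc (suc (2 * size cs))
2*size-singleton cs = trans (2*size-∷ cs []) (+-identityʳ _)

2*size-split : ∀ cs ts → 2 * size (node cs ∷ ts) ≡ 2 * size (node cs ∷ []) + 2 * size ts
2*size-split cs ts = trans (2*size-∷ cs ts) (cong (_+ 2 * size ts) (sym (2*size-singleton cs)))

length-Pl : ∀ fs (ℓ : Node fs → ℕ) → length (Pl fs ℓ) ≡ 2 * size fs
length-Pl [] ℓ = refl
length-Pl (node cs ∷ ts) ℓ = begin
  suc (length (Pl cs (ℓ ∘ below) ++ (false , ℓ root) ∷ Pl ts (ℓ ∘ there)))
    ≡⟨ cong suc (length-++ (Pl cs (ℓ ∘ below))) ⟩
  suc (length (Pl cs (ℓ ∘ below)) + suc (length (Pl ts (ℓ ∘ there))))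
    ≡⟨ cong₂ (λ a b → suc (a + suc b)) (length-Pl cs (ℓ ∘ below)) (length-Pl ts (ℓ ∘ there)) ⟩
  suc (2 * size cs + suc (2 * size ts))
    ≡⟨ cong suc (+-suc (2 * size cs) (2 * size ts)) ⟩
  suc (suc (2 * size cs)) + 2 * size ts
    ≡⟨ 2*size-∷ cs ts ⟨
  2 * size (node cs ∷ ts) ∎

map-proj₁-Pl : ∀ fs (ℓ : Node fs → ℕ) → map proj₁ (Pl fs ℓ) ≡ P fs
map-proj₁-Pl [] ℓ = refl
map-proj₁-Pl (node cs ∷ ts) ℓ = cong (true ∷_)
  (trans (map-++ proj₁ (Pl cs (ℓ ∘ below)) _)
    (cong₂ _++_ (map-proj₁-Pl cs (ℓ ∘ below)) (cong (false ∷_) (map-proj₁-Pl ts (ℓ ∘ there)))))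

length-P : ∀ fs → length (P fs) ≡ 2 * size fs
length-P fs = begin
  length (P fs)                       ≡⟨ cong length (map-proj₁-Pl fs (λ _ → 0)) ⟨
  length (map proj₁ (Pl fs (λ _ → 0))) ≡⟨ length-map proj₁ (Pl fs _) ⟩
  length (Pl fs (λ _ → 0))            ≡⟨ length-Pl fs _ ⟩
  2 * size fs                         ∎

o<c : ∀ {fs} (a : Node fs) → o a < c a
o<c root = s≤s z≤n
o<c (below a) = s≤s (o<c a)
o<c (there {t} a) = +-monoʳ-< (2 * size (t ∷ [])) (o<c a)

c<2*size : ∀ {fs} (a : Node fs) → c a < 2 * size fs
c<2*size {node cs ∷ ts} root =
  subst (suc (suc (2 * size cs)) ≤_) (sym (2*size-∷ cs ts)) (m≤m+n _ (2 * size ts))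
c<2*size {node cs ∷ ts} (below a) =
  subst (suc (suc (c a)) ≤_) (sym (2*size-∷ cs ts)) (≤-trans (s≤s (c<2*size a)) (≤-trans (n≤1+n _) (m≤m+n _ (2 * size ts))))
c<2*size {node cs ∷ ts} (there a) =
  subst (c (there {node cs} a) <_) (sym (2*size-split cs ts)) (+-monoʳ-< (2 * size (node cs ∷ [])) (c<2*size a))

o<2*size : ∀ {fs} (a : Node fs) → o a < 2 * size fs
o<2*size a = <-trans (o<c a) (c<2*size a)

Pl-!-below : ∀ cs ts (ℓ : Node (node cs ∷ ts) → ℕ) {n} → n < 2 * size cs →
  Pl (node cs ∷ ts) ℓ ! suc n ≡ Pl cs (ℓ ∘ below) ! n
Pl-!-below cs ts ℓ n< = !-++ˡ (Pl cs (ℓ ∘ below)) _ (subst (_ <_) (sym (length-Pl cs (ℓ ∘ below))) n<)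

Pl-!-there : ∀ cs ts (ℓ : Node (node cs ∷ ts) → ℕ) n →
  Pl (node cs ∷ ts) ℓ ! (2 * size (node cs ∷ []) + n) ≡ Pl ts (ℓ ∘ there) ! n
Pl-!-there cs ts ℓ n = begin
  Pl (node cs ∷ ts) ℓ ! (2 * size (node cs ∷ []) + n)
    ≡⟨ cong (_! (2 * size (node cs ∷ []) + n)) (cong ((true , ℓ root) ∷_) (++-assoc (Pl cs (ℓ ∘ below)) _ _)) ⟨
  (firstTree ++ Pl ts (ℓ ∘ there)) ! (2 * size (node cs ∷ []) + n)
    ≡⟨ !-++ʳ firstTree (Pl ts (ℓ ∘ there)) n length-firstTree ⟩
  Pl ts (ℓ ∘ there) ! n ∎
  where
  firstTree : List Sym
  firstTree = (true , ℓ root) ∷ Pl cs (ℓ ∘ below) ++ (false , ℓ root) ∷ []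
  length-firstTree : length firstTree ≡ 2 * size (node cs ∷ [])
  length-firstTree = begin
    suc (length (Pl cs (ℓ ∘ below) ++ (false , ℓ root) ∷ [])) ≡⟨ cong suc (length-++ (Pl cs (ℓ ∘ below))) ⟩
    suc (length (Pl cs (ℓ ∘ below)) + 1)                      ≡⟨ cong (λ m → suc (m + 1)) (length-Pl cs (ℓ ∘ below)) ⟩
    suc (2 * size cs + 1)                                      ≡⟨ cong suc (+-comm (2 * size cs) 1) ⟩
    suc (suc (2 * size cs))                                    ≡⟨ 2*size-singleton cs ⟨
    2 * size (node cs ∷ []) ∎

Pl-!-o : ∀ fs (ℓ : Node fs → ℕ) (a : Node fs) → Pl fs ℓ ! o a ≡ just (true , ℓ a)
Pl-!-o (node cs ∷ ts) ℓ root = refl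
Pl-!-o (node cs ∷ ts) ℓ (below a) = trans (Pl-!-below cs ts ℓ (o<2*size a)) (Pl-!-o cs (ℓ ∘ below) a)
Pl-!-o (node cs ∷ ts) ℓ (there a) = trans (Pl-!-there cs ts ℓ (o a)) (Pl-!-o ts (ℓ ∘ there) a)

Pl-!-c : ∀ fs (ℓ : Node fs → ℕ) (a : Node fs) → Pl fs ℓ ! c a ≡ just (false , ℓ a)
Pl-!-c (node cs ∷ ts) ℓ root =
  trans (cong (Pl (node cs ∷ ts) ℓ !_) (sym (+-identityʳ (suc (2 * size cs)))))
        (!-++ʳ ((true , ℓ root) ∷ Pl cs (ℓ ∘ below)) _ 0 (cong suc (length-Pl cs (ℓ ∘ below))))
Pl-!-c (node cs ∷ ts) ℓ (below a) = trans (Pl-!-below cs ts ℓ (c<2*size a)) (Pl-!-c cs (ℓ ∘ below) a)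
Pl-!-c (node cs ∷ ts) ℓ (there a) = trans (Pl-!-there cs ts ℓ (c a)) (Pl-!-c ts (ℓ ∘ there) a)

-- Laminarity of the parentheses

parenthesisAt : ∀ fs x → x < 2 * size fs → ∃ λ (a : Node fs) → o a ≡ x ⊎ c a ≡ x
parenthesisAt (node cs ∷ ts) zero _ = root , inj₁ refl
parenthesisAt (node cs ∷ ts) (suc x) x< with <-cmp x (2 * size cs)
... | tri< x<cs _ _ = let (a , e) = parenthesisAt cs x x<cs in below a , map⊎ (cong suc) (cong suc) e
... | tri≈ _ x≡cs _ = root , inj₂ (cong suc (sym x≡cs))
... | tri> _ _ cs<x with m≤n⇒∃[o]m+o≡n (subst (_≤ suc x) (sym (2*size-singleton cs)) (s≤s cs<x))
...   | z , offset+z≡ with parenthesisAt ts z (+-cancelˡ-< (2 * size (node cs ∷ [])) z (2 * size ts)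
                                                (subst₂ _<_ (sym offset+z≡) (2*size-split cs ts) x<))
...     | a , e = there a , map⊎ shift shift e
  where
  shift : ∀ {n} → n ≡ z → 2 * size (node cs ∷ []) + n ≡ suc x
  shift refl = offset+z≡

data Laminar {fs} (a u : Node fs) : Set where
  same    : a ≡ u → Laminar a u
  inside  : o u < o a → c a < c u → Laminar a u
  outside : o a < o u → c u < c a → Laminar a u
  before  : c a < o u → Laminar a u
  after   : c u < o a → Laminar a u

c-below<c-root : ∀ {cs ts} (a : Node cs) → c (below {cs} {ts} a) < c (root {cs} {ts})
c-below<c-root a = s≤s (c<2*size a)

c-root<there : ∀ {cs ts} n → c (root {cs} {ts}) < 2 * size (node cs ∷ []) + n
c-root<there {cs} n = subst (_≤ 2 * size (node cs ∷ []) + n) (2*size-singleton cs) (m≤m+n _ n)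

c-below<there : ∀ {cs ts} (a : Node cs) n → c (below {cs} {ts} a) < 2 * size (node cs ∷ []) + n
c-below<there {cs} {ts} a n = <-trans (c-below<c-root {cs} {ts} a) (c-root<there {cs} {ts} n)

laminar : ∀ {fs} (a u : Node fs) → Laminar a u
laminar root root = same refl
laminar {node cs ∷ ts} root (below u) = outside (s≤s z≤n) (c-below<c-root {cs} {ts} u)
laminar {node cs ∷ ts} root (there u) = before (c-root<there {cs} {ts} (o u))
laminar {node cs ∷ ts} (below a) root = inside (s≤s z≤n) (c-below<c-root {cs} {ts} a)
laminar (below a) (below u) = shift-below (laminar a u)
  where
  shift-below : ∀ {cs ts} {a u : Node cs} → Laminar a u → Laminar {node cs ∷ ts} (below a) (below u)
  shift-below (same refl) = same refl
  shift-below (inside p q) = inside (s≤s p) (s≤s q)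
  shift-below (outside p q) = outside (s≤s p) (s≤s q)
  shift-below (before p) = before (s≤s p)
  shift-below (after p) = after (s≤s p)
laminar {node cs ∷ ts} (below a) (there u) = before (c-below<there {cs} {ts} a (o u))
laminar {node cs ∷ ts} (there a) root = after (c-root<there {cs} {ts} (o a))
laminar {node cs ∷ ts} (there a) (below u) = after (c-below<there {cs} {ts} u (o a))
laminar {t ∷ ts} (there a) (there u) = shift-there (laminar a u)
  where
  shift : ∀ {m n} → m < n → 2 * size (t ∷ []) + m < 2 * size (t ∷ []) + n
  shift = +-monoʳ-< (2 * size (t ∷ []))
  shift-there : ∀ {a u : Node ts} → Laminar a u → Laminar {t ∷ ts} (there a) (there u)
  shift-there (same refl) = same refl
  shift-there (inside p q) = inside (shift p) (shift q)
  shift-there (outside p q) = outside (shift p) (shift q)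
  shift-there (before p) = before (shift p)
  shift-there (after p) = after (shift p)

c-injective : ∀ {fs} {a b : Node fs} → c a ≡ c b → a ≡ b
c-injective {a = a} {b} e with laminar a b
... | same p = p
... | inside _ p = ⊥-elim (<⇒≢ p e)
... | outside _ p = ⊥-elim (<⇒≢ p (sym e))
... | before p = ⊥-elim (<⇒≢ (<-trans p (o<c b)) e)
... | after p = ⊥-elim (<⇒≢ (<-trans p (o<c a)) (sym e))

Outside : ∀ {fs} → Node fs → ℕ → Set
Outside u x = x < o u ⊎ c u < x

data Nesting {fs} (u a : Node fs) : Set where
  descendant : o u ≤ o a → c a ≤ c u → Nesting u a
  unrelated  : Outside u (o a) → Outside u (c a) → Nesting u a

nesting : ∀ {fs} (u a : Node fs) → Nesting u a
nesting u a with laminar a u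
... | same refl = descendant ≤-refl ≤-refl
... | inside p q = descendant (<⇒≤ p) (<⇒≤ q)
... | outside p q = unrelated (inj₁ p) (inj₂ q)
... | before p = unrelated (inj₁ (<-trans (o<c a) p)) (inj₁ p)
... | after p = unrelated (inj₂ p) (inj₂ (<-trans p (o<c a)))

-- Subtrees

subtree : ∀ {fs} → Node fs → Tree
subtree (root {cs}) = node cs
subtree (below a) = subtree a
subtree (there a) = subtree a

embed : ∀ {fs} (u : Node fs) → Node (subtree u ∷ []) → Node fs
embed root root = root
embed root (below w) = below w
embed (below u) w = below (embed u w)
embed (there u) w = there (embed u w)

subtreeRoot : ∀ {fs} (u : Node fs) → Node (subtree u ∷ [])
subtreeRoot root = root
subtreeRoot (below u) = subtreeRoot u
subtreeRoot (there u) = subtreeRoot u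

embed-subtreeRoot : ∀ {fs} (u : Node fs) → embed u (subtreeRoot u) ≡ u
embed-subtreeRoot root = refl
embed-subtreeRoot (below u) = cong below (embed-subtreeRoot u)
embed-subtreeRoot (there u) = cong there (embed-subtreeRoot u)

o-embed : ∀ {fs} (u : Node fs) w → o (embed u w) ≡ o u + o w
o-embed root root = refl
o-embed root (below w) = refl
o-embed (below u) w = cong suc (o-embed u w)
o-embed (there {t} u) w = trans (cong (2 * size (t ∷ []) +_) (o-embed u w)) (sym (+-assoc (2 * size (t ∷ [])) (o u) (o w)))

c-embed : ∀ {fs} (u : Node fs) w → c (embed u w) ≡ o u + c w
c-embed root root = refl
c-embed root (below w) = refl
c-embed (below u) w = cong suc (c-embed u w)
c-embed (there {t} u) w = trans (cong (2 * size (t ∷ []) +_) (c-embed u w)) (sym (+-assoc (2 * size (t ∷ [])) (o u) (c w)))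

PlSub-embed : ∀ d {fs} (ℓ : Node fs → ℕ) (u : Node fs) w →
  PlSub d fs ℓ (embed u w) ≡ PlSub d (subtree u ∷ []) (ℓ ∘ embed u) w
PlSub-embed zero ℓ root root = refl
PlSub-embed (suc d) ℓ root root = refl
PlSub-embed zero ℓ root (below w) = refl
PlSub-embed (suc d) ℓ root (below w) = refl
PlSub-embed zero ℓ (below u) w = PlSub-embed zero (ℓ ∘ below) u w
PlSub-embed (suc d) ℓ (below u) w = PlSub-embed (suc d) (ℓ ∘ below) u w
PlSub-embed zero ℓ (there {node _} u) w = PlSub-embed zero (ℓ ∘ there) u w
PlSub-embed (suc d) ℓ (there {node _} u) w = PlSub-embed (suc d) (ℓ ∘ there) u w

width : ∀ {fs} → Node fs → ℕ
width u = 2 * size (subtree u ∷ [])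

suc-c≡o+width : ∀ {fs} (u : Node fs) → suc (c u) ≡ o u + width u
suc-c≡o+width (root {cs}) = sym (2*size-singleton cs)
suc-c≡o+width (below u) = cong suc (suc-c≡o+width u)
suc-c≡o+width (there {t} u) = begin
  suc (2 * size (t ∷ []) + c u) ≡⟨ +-suc (2 * size (t ∷ [])) (c u) ⟨
  2 * size (t ∷ []) + suc (c u) ≡⟨ cong (2 * size (t ∷ []) +_) (suc-c≡o+width u) ⟩
  2 * size (t ∷ []) + (o u + width u) ≡⟨ +-assoc (2 * size (t ∷ [])) (o u) _ ⟨
  2 * size (t ∷ []) + o u + width u ∎

width≡suc : ∀ {fs} (u : Node fs) → width u ≡ suc (pred (width u))
width≡suc root = refl
width≡suc (below u) = width≡suc u
width≡suc (there u) = width≡suc u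

descendant⇒embedded : ∀ {fs} (u a : Node fs) → o u ≤ o a → c a ≤ c u → ∃ λ w → embed u w ≡ a
descendant⇒embedded root root _ _ = root , refl
descendant⇒embedded root (below a) _ _ = below a , refl
descendant⇒embedded {node cs ∷ ts} root (there a) _ ca≤ = ⊥-elim (<⇒≱ (c-root<there {cs} {ts} (c a)) ca≤)
descendant⇒embedded (below u) (below a) (s≤s oa≥) (s≤s ca≤) =
  let (w , e) = descendant⇒embedded u a oa≥ ca≤ in w , cong below e
descendant⇒embedded {node cs ∷ ts} (below u) (there a) _ ca≤ = ⊥-elim (<⇒≱ (c-below<there {cs} {ts} u (c a)) ca≤)
descendant⇒embedded {node cs ∷ ts} (there u) (below a) oa≥ _ =
  ⊥-elim (<⇒≱ (<-trans (o<c (below {cs} {ts} a)) (c-below<there {cs} {ts} a (o u))) oa≥)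
descendant⇒embedded (there {t} u) (there a) oa≥ ca≤ =
  let (w , e) = descendant⇒embedded u a (+-cancelˡ-≤ (2 * size (t ∷ [])) _ _ oa≥) (+-cancelˡ-≤ (2 * size (t ∷ [])) _ _ ca≤)
  in w , cong there e

PlTrunc-height : ∀ d fs (ℓ : Node fs → ℕ) → height fs ≤ d → PlTrunc d fs ℓ ≡ Pl fs ℓ
PlTrunc-height zero [] ℓ _ = refl
PlTrunc-height zero (node cs ∷ ts) ℓ h≤ = ⊥-elim (<⇒≱ (s≤s z≤n) (≤-trans (m≤m⊔n (suc (height cs)) (height ts)) h≤))
PlTrunc-height (suc d) [] ℓ _ = refl
PlTrunc-height (suc d) (node cs ∷ ts) ℓ h≤ =
  cong₂ (λ a b → (true , ℓ root) ∷ a ++ (false , ℓ root) ∷ b)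
    (PlTrunc-height d cs (ℓ ∘ below) (s≤s⁻¹ (m⊔n≤o⇒m≤o (suc (height cs)) (height ts) h≤)))
    (PlTrunc-height (suc d) ts (ℓ ∘ there) (m⊔n≤o⇒n≤o (suc (height cs)) (height ts) h≤))

height-subtree : ∀ {fs} (u : Node fs) → height (subtree u ∷ []) ≤ height fs
height-subtree (root {cs} {ts}) =
  subst (_≤ suc (height cs) ⊔ height ts) (sym (⊔-identityʳ (suc (height cs)))) (m≤m⊔n (suc (height cs)) (height ts))
height-subtree (below {cs} {ts} u) = ≤-trans (height-subtree u) (≤-trans (n≤1+n _) (m≤m⊔n (suc (height cs)) (height ts)))
height-subtree (there {node cs} {ts} u) = ≤-trans (height-subtree u) (m≤n⊔m (suc (height cs)) (height ts))

PlSub-subtreeRoot : ∀ h {fs} (u : Node fs) (ℓ : Node (subtree u ∷ []) → ℕ) → height (subtree u ∷ []) ≤ h →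
  PlSub h (subtree u ∷ []) ℓ (subtreeRoot u) ≡ Pl (subtree u ∷ []) ℓ
PlSub-subtreeRoot zero root ℓ h≤ = ⊥-elim (<⇒≱ (s≤s z≤n) h≤)
PlSub-subtreeRoot (suc d) (root {cs}) ℓ h≤ = cong (λ a → (true , ℓ root) ∷ a ++ (false , ℓ root) ∷ [])
  (PlTrunc-height d cs (ℓ ∘ below) (s≤s⁻¹ (m⊔n≤o⇒m≤o (suc (height cs)) 0 h≤)))
PlSub-subtreeRoot h (below u) = PlSub-subtreeRoot h u
PlSub-subtreeRoot h (there u) = PlSub-subtreeRoot h u

PlSub-height : ∀ h {fs} (ℓ : Node fs → ℕ) (u : Node fs) → height fs ≤ h →
  PlSub h fs ℓ u ≡ Pl (subtree u ∷ []) (ℓ ∘ embed u)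
PlSub-height h ℓ u h≤ = begin
  PlSub h _ ℓ u                                            ≡⟨ cong (PlSub h _ ℓ) (embed-subtreeRoot u) ⟨
  PlSub h _ ℓ (embed u (subtreeRoot u))                    ≡⟨ PlSub-embed h ℓ u (subtreeRoot u) ⟩
  PlSub h (subtree u ∷ []) (ℓ ∘ embed u) (subtreeRoot u)   ≡⟨ PlSub-subtreeRoot h u (ℓ ∘ embed u) (≤-trans (height-subtree u) h≤) ⟩
  Pl (subtree u ∷ []) (ℓ ∘ embed u)                        ∎

P-++-injective : ∀ fs gs r r′ → P fs ++ false ∷ r ≡ P gs ++ false ∷ r′ → fs ≡ gs × r ≡ r′
P-++-injective [] [] r r′ refl = refl , refl
P-++-injective [] (node ds ∷ us) r r′ ()
P-++-injective (node cs ∷ ts) [] r r′ ()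
P-++-injective (node cs ∷ ts) (node ds ∷ us) r r′ e =
  let e′ = begin
        P cs ++ false ∷ (P ts ++ false ∷ r)   ≡⟨ ++-assoc (P cs) (false ∷ P ts) (false ∷ r) ⟨
        (P cs ++ false ∷ P ts) ++ false ∷ r   ≡⟨ ∷-injectiveʳ e ⟩
        (P ds ++ false ∷ P us) ++ false ∷ r′  ≡⟨ ++-assoc (P ds) (false ∷ P us) (false ∷ r′) ⟩
        P ds ++ false ∷ (P us ++ false ∷ r′)  ∎
      (cs≡ds , rest) = P-++-injective cs ds _ _ e′
      (ts≡us , r≡r′) = P-++-injective ts us r r′ rest
  in cong₂ (λ as bs → node as ∷ bs) cs≡ds ts≡us , r≡r′

P-injective : ∀ fs gs → P fs ≡ P gs → fs ≡ gs
P-injective fs gs e = proj₁ (P-++-injective fs gs [] [] (cong (_++ false ∷ []) e))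

Pl-labels : ∀ fs (ℓ ℓ′ : Node fs → ℕ) → Pl fs ℓ ≡ Pl fs ℓ′ → ∀ w → ℓ w ≡ ℓ′ w
Pl-labels fs ℓ ℓ′ e w =
  proj₂ (,-injective (just-injective (trans (sym (Pl-!-o fs ℓ w)) (trans (cong (_! o w) e) (Pl-!-o fs ℓ′ w)))))

PlTrunc-cong : ∀ d fs {ℓ ℓ′ : Node fs → ℕ} → (∀ w → ℓ w ≡ ℓ′ w) → PlTrunc d fs ℓ ≡ PlTrunc d fs ℓ′
PlTrunc-cong zero fs e = refl
PlTrunc-cong (suc d) [] e = refl
PlTrunc-cong (suc d) (node cs ∷ ts) e =
  cong₂ _∷_ (cong (true ,_) (e root))
    (cong₂ _++_ (PlTrunc-cong d cs (e ∘ below))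
       (cong₂ _∷_ (cong (false ,_) (e root)) (PlTrunc-cong (suc d) ts (e ∘ there))))

PlSub-cong : ∀ d fs {ℓ ℓ′ : Node fs → ℕ} → (∀ w → ℓ w ≡ ℓ′ w) → ∀ a → PlSub d fs ℓ a ≡ PlSub d fs ℓ′ a
PlSub-cong zero (node cs ∷ ts) e root = refl
PlSub-cong (suc d) (node cs ∷ ts) e root =
  cong₂ _∷_ (cong (true ,_) (e root))
    (cong₂ _++_ (PlTrunc-cong d cs (e ∘ below)) (cong (λ z → (false , z) ∷ []) (e root)))
PlSub-cong zero (node cs ∷ ts) e (below a) = PlSub-cong zero cs (e ∘ below) a
PlSub-cong (suc d) (node cs ∷ ts) e (below a) = PlSub-cong (suc d) cs (e ∘ below) a
PlSub-cong zero (node _ ∷ ts) e (there a) = PlSub-cong zero ts (e ∘ there) a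
PlSub-cong (suc d) (node _ ∷ ts) e (there a) = PlSub-cong (suc d) ts (e ∘ there) a

Pl-singleton-shape : ∀ {t t′} {ℓ : Node (t ∷ []) → ℕ} {ℓ′ : Node (t′ ∷ []) → ℕ} →
  Pl (t ∷ []) ℓ ≡ Pl (t′ ∷ []) ℓ′ → t ≡ t′
Pl-singleton-shape {t} {t′} {ℓ} {ℓ′} e = ∷-injectiveˡ (P-injective (t ∷ []) (t′ ∷ []) (begin
  P (t ∷ [])                    ≡⟨ map-proj₁-Pl (t ∷ []) ℓ ⟨
  map proj₁ (Pl (t ∷ []) ℓ)     ≡⟨ cong (map proj₁) e ⟩
  map proj₁ (Pl (t′ ∷ []) ℓ′)   ≡⟨ map-proj₁-Pl (t′ ∷ []) ℓ′ ⟩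
  P (t′ ∷ [])                   ∎))

Pl-singleton-node : ∀ {t t′} (ℓ : Node (t ∷ []) → ℕ) (ℓ′ : Node (t′ ∷ []) → ℕ) → Pl (t ∷ []) ℓ ≡ Pl (t′ ∷ []) ℓ′ →
  (w : Node (t ∷ [])) → ∃ λ (w′ : Node (t′ ∷ [])) →
    o w ≡ o w′ × c w ≡ c w′ × ℓ w ≡ ℓ′ w′ × (∀ d → PlSub d (t ∷ []) ℓ w ≡ PlSub d (t′ ∷ []) ℓ′ w′)
Pl-singleton-node {t} ℓ ℓ′ e w with Pl-singleton-shape e
... | refl = w , refl , refl , labels w , λ d → PlSub-cong d (t ∷ []) labels w
  where
  labels : ∀ w → ℓ w ≡ ℓ′ w
  labels = Pl-labels (t ∷ []) ℓ ℓ′ e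

Pl-!-matching : ∀ {F G} (κ : Labeling F G) {a b} → κ (inj₁ a) ≡ κ (inj₂ b) →
  (PlF F G κ ! o a ≡ PlG F G κ ! o b) × (PlF F G κ ! c a ≡ PlG F G κ ! c b)
Pl-!-matching {F} {G} κ {a} {b} e =
  trans (Pl-!-o F (κ ∘ inj₁) a) (trans (cong (λ n → just (true , n)) e) (sym (Pl-!-o G (κ ∘ inj₂) b))) ,
  trans (Pl-!-c F (κ ∘ inj₁) a) (trans (cong (λ n → just (false , n)) e) (sym (Pl-!-c G (κ ∘ inj₂) b)))

Pl-!-just : ∀ fs (ℓ : Node fs → ℕ) z {b n} → Pl fs ℓ ! z ≡ just (b , n) →
  ∃ λ a → n ≡ ℓ a × (o a ≡ z × b ≡ true ⊎ c a ≡ z × b ≡ false)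
Pl-!-just fs ℓ z {b} {n} e with parenthesisAt fs z (subst (z <_) (length-Pl fs ℓ) (!≡just⇒< (Pl fs ℓ) z e))
... | a , inj₁ refl = let (b≡ , n≡) = ,-injective (just-injective (trans (sym e) (Pl-!-o fs ℓ a))) in a , n≡ , inj₁ (refl , b≡)
... | a , inj₂ refl = let (b≡ , n≡) = ,-injective (just-injective (trans (sym e) (Pl-!-c fs ℓ a))) in a , n≡ , inj₂ (refl , b≡)

Pl-!-matching⁻¹ : ∀ {F G} (κ : Labeling F G) x y {e} → PlF F G κ ! x ≡ just e → PlG F G κ ! y ≡ just e →
  ∃ λ a → ∃ λ b → κ (inj₁ a) ≡ κ (inj₂ b) × (o a ≡ x × o b ≡ y ⊎ c a ≡ x × c b ≡ y)
Pl-!-matching⁻¹ {F} {G} κ x y ex ey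
  with Pl-!-just F (κ ∘ inj₁) x ex | Pl-!-just G (κ ∘ inj₂) y ey
... | a , n≡a , inj₁ (oa≡ , refl) | b , n≡b , inj₁ (ob≡ , _) = a , b , trans (sym n≡a) n≡b , inj₁ (oa≡ , ob≡)
... | a , n≡a , inj₂ (ca≡ , refl) | b , n≡b , inj₂ (cb≡ , _) = a , b , trans (sym n≡a) n≡b , inj₂ (ca≡ , cb≡)
... | _ , _ , inj₁ (_ , refl) | _ , _ , inj₂ (_ , ())
... | _ , _ , inj₂ (_ , refl) | _ , _ , inj₁ (_ , ())

module Counterparts {F G : Forest} {h : ℕ} (ℓF : Node F → ℕ) (ℓG : Node G → ℕ) (hF : height F ≤ h) (hG : height G ≤ h)
         {u : Node F} {v : Node G} (same-PlSub : PlSub h F ℓF u ≡ PlSub h G ℓG v) where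

  Pl-subtree-≡ : Pl (subtree u ∷ []) (ℓF ∘ embed u) ≡ Pl (subtree v ∷ []) (ℓG ∘ embed v)
  Pl-subtree-≡ = trans (sym (PlSub-height h ℓF u hF)) (trans same-PlSub (PlSub-height h ℓG v hG))

  width-≡ : width u ≡ width v
  width-≡ = cong (λ t → 2 * size (t ∷ [])) (Pl-singleton-shape Pl-subtree-≡)

  record Counterpart (a : Node F) : Set where
    field
      b : Node G
      i j : ℕ
      o-a : o a ≡ o u + i
      o-b : o b ≡ o v + i
      c-a : c a ≡ o u + j
      c-b : c b ≡ o v + j
      i<width : i < width u
      j<width : j < width u
      label-≡ : ℓF a ≡ ℓG b
      PlSub-≡ : PlSub h F ℓF a ≡ PlSub h G ℓG b

  counterpart : (a : Node F) → o u ≤ o a → c a ≤ c u → Counterpart a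
  counterpart a oa≥ ca≤ with descendant⇒embedded u a oa≥ ca≤
  ... | w , refl with Pl-singleton-node (ℓF ∘ embed u) (ℓG ∘ embed v) Pl-subtree-≡ w
  ...   | w′ , o≡ , c≡ , ℓ≡ , sub≡ = record
    { b = embed v w′ ; i = o w ; j = c w
    ; o-a = o-embed u w
    ; o-b = trans (o-embed v w′) (cong (o v +_) (sym o≡))
    ; c-a = c-embed u w
    ; c-b = trans (c-embed v w′) (cong (o v +_) (sym c≡))
    ; i<width = o<2*size w
    ; j<width = c<2*size w
    ; label-≡ = ℓ≡
    ; PlSub-≡ = trans (PlSub-embed h ℓF u w) (trans (sub≡ h) (sym (PlSub-embed h ℓG v w′)))
    }

equal-PlSub-not-nested : ∀ h {fs} (ℓ : Node fs → ℕ) → height fs ≤ h → (a u : Node fs) →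
  PlSub h fs ℓ a ≡ PlSub h fs ℓ u → o a < o u → c u < c a → ⊥
equal-PlSub-not-nested h ℓ h≤ a u e oa<ou cu<ca = <-asym cu<ca (s≤s⁻¹ (subst₂ _<_
  (sym (suc-c≡o+width a))
  (trans (cong (o u +_) (Counterparts.width-≡ ℓ ℓ h≤ h≤ e)) (sym (suc-c≡o+width u)))
  (+-monoˡ-< (width a) oa<ou)))

-- Steps and costs of alignments

-- At A i j s: the step of A leaving the point (i , j) is s.
data At : List Step → ℕ → ℕ → Step → Set where
  now   : ∀ {s R} → At (s ∷ R) 0 0 s
  later : ∀ {s R i j s′} → At R i j s′ → At (s ∷ R) (dx s + i) (dy s + j) s′

sumX-++ : ∀ R₁ R₂ → sumX (R₁ ++ R₂) ≡ sumX R₁ + sumX R₂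
sumX-++ [] R₂ = refl
sumX-++ (s ∷ R₁) R₂ = trans (cong (dx s +_) (sumX-++ R₁ R₂)) (sym (+-assoc (dx s) _ _))

sumY-++ : ∀ R₁ R₂ → sumY (R₁ ++ R₂) ≡ sumY R₁ + sumY R₂
sumY-++ [] R₂ = refl
sumY-++ (s ∷ R₁) R₂ = trans (cong (dy s +_) (sumY-++ R₁ R₂)) (sym (+-assoc (dy s) _ _))

sumX-replicate : ∀ n s → sumX (replicate n s) ≡ n * dx s
sumX-replicate zero s = refl
sumX-replicate (suc n) s = cong (dx s +_) (sumX-replicate n s)

sumY-replicate : ∀ n s → sumY (replicate n s) ≡ n * dy s
sumY-replicate zero s = refl
sumY-replicate (suc n) s = cong (dy s +_) (sumY-replicate n s)

trace⇒At : ∀ A x₀ y₀ {x y s} → (x , y , just s) ∈ trace x₀ y₀ A →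
  ∃ λ i → ∃ λ j → At A i j s × x ≡ x₀ + i × y ≡ y₀ + j
trace⇒At (s ∷ A) x₀ y₀ (here refl) = 0 , 0 , now , sym (+-identityʳ x₀) , sym (+-identityʳ y₀)
trace⇒At (s ∷ A) x₀ y₀ (there m) =
  let (i , j , a , ex , ey) = trace⇒At A (x₀ + dx s) (y₀ + dy s) m
  in dx s + i , dy s + j , later a , trans ex (+-assoc x₀ (dx s) i) , trans ey (+-assoc y₀ (dy s) j)
trace⇒At [] x₀ y₀ (there ())

At⇒trace : ∀ {A i j s} x₀ y₀ → At A i j s → (x₀ + i , y₀ + j , just s) ∈ trace x₀ y₀ A
At⇒trace {s = s} x₀ y₀ now = here (cong₂ (λ a b → a , b , just s) (+-identityʳ x₀) (+-identityʳ y₀))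
At⇒trace {t ∷ A} {s = s} x₀ y₀ (later {i = i} {j} a) =
  there (subst (_∈ trace (x₀ + dx t) (y₀ + dy t) A)
               (cong₂ (λ p q → p , q , just s) (+-assoc x₀ (dx t) i) (+-assoc y₀ (dy t) j))
               (At⇒trace (x₀ + dx t) (y₀ + dy t) a))

trace-end : ∀ A x₀ y₀ {x y} → (x , y , nothing) ∈ trace x₀ y₀ A → x ≡ x₀ + sumX A × y ≡ y₀ + sumY A
trace-end [] x₀ y₀ (here refl) = sym (+-identityʳ x₀) , sym (+-identityʳ y₀)
trace-end (s ∷ A) x₀ y₀ (there m) =
  let (ex , ey) = trace-end A (x₀ + dx s) (y₀ + dy s) m
  in trans ex (+-assoc x₀ (dx s) _) , trans ey (+-assoc y₀ (dy s) _)
trace-end [] x₀ y₀ (there ())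

Deletes⇒At : ∀ {A x} → Deletes A x → ∃ λ j → At A x j D
Deletes⇒At {A} (_ , m) = let (i , j , a , ex , _) = trace⇒At A 0 0 m in j , subst (λ t → At A t j D) (sym ex) a

At⇒Deletes : ∀ {A x j} → At A x j D → Deletes A x
At⇒Deletes {j = j} a = j , At⇒trace 0 0 a

AlignsWith⇒At : ∀ {A x y} → AlignsWith A x y → At A x y M
AlignsWith⇒At {A} m = let (i , j , a , ex , ey) = trace⇒At A 0 0 m in subst₂ (λ p q → At A p q M) (sym ex) (sym ey) a

At⇒AlignsWith : ∀ {A x y} → At A x y M → AlignsWith A x y
At⇒AlignsWith = At⇒trace 0 0

At-split : ∀ {A i j s} → At A i j s → ∃ λ A₁ → ∃ λ A₂ → A ≡ A₁ ++ s ∷ A₂ × sumX A₁ ≡ i × sumY A₁ ≡ j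
At-split {s ∷ R} now = [] , R , refl , refl , refl
At-split {s ∷ R} (later a) =
  let (A₁ , A₂ , e , ex , ey) = At-split a in s ∷ A₁ , A₂ , cong (s ∷_) e , cong (dx s +_) ex , cong (dy s +_) ey

At-middle : ∀ A₁ s A₂ → At (A₁ ++ s ∷ A₂) (sumX A₁) (sumY A₁) s
At-middle [] s A₂ = now
At-middle (t ∷ A₁) s A₂ = later (At-middle A₁ s A₂)

At-++ˡ : ∀ {A₁ i j s} A₂ → At A₁ i j s → At (A₁ ++ A₂) i j s
At-++ˡ A₂ now = now
At-++ˡ A₂ (later a) = later (At-++ˡ A₂ a)

At-++ʳ : ∀ A₁ {A₂ i j s} → At A₂ i j s → At (A₁ ++ A₂) (sumX A₁ + i) (sumY A₁ + j) s
At-++ʳ [] a = a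
At-++ʳ (t ∷ A₁) {A₂} {i} {j} {s} a =
  subst₂ (λ p q → At (t ∷ A₁ ++ A₂) p q s) (sym (+-assoc (dx t) (sumX A₁) i)) (sym (+-assoc (dy t) (sumY A₁) j))
         (later (At-++ʳ A₁ a))

At-++⁻ : ∀ A₁ {A₂ i j s} → At (A₁ ++ A₂) i j s →
  At A₁ i j s ⊎ ∃ λ i′ → ∃ λ j′ → At A₂ i′ j′ s × i ≡ sumX A₁ + i′ × j ≡ sumY A₁ + j′
At-++⁻ [] a = inj₂ (_ , _ , a , refl , refl)
At-++⁻ (t ∷ A₁) now = inj₁ now
At-++⁻ (t ∷ A₁) (later a) with At-++⁻ A₁ a
... | inj₁ b = inj₁ (later b)
... | inj₂ (i′ , j′ , b , ei , ej) =
  inj₂ (i′ , j′ , b , trans (cong (dx t +_) ei) (sym (+-assoc (dx t) _ _)) , trans (cong (dy t +_) ej) (sym (+-assoc (dy t) _ _)))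

+-monoʳ-≤-assoc : ∀ d {m e n} → m + e ≤ n → d + m + e ≤ d + n
+-monoʳ-≤-assoc d {m} {e} {n} p = subst (_≤ d + n) (sym (+-assoc d m e)) (+-monoʳ-≤ d p)

At-bounded : ∀ {A i j s} → At A i j s → i + dx s ≤ sumX A × j + dy s ≤ sumY A
At-bounded {s ∷ R} now = m≤m+n (dx s) (sumX R) , m≤m+n (dy s) (sumY R)
At-bounded {t ∷ R} (later a) =
  let (p , q) = At-bounded a in +-monoʳ-≤-assoc (dx t) p , +-monoʳ-≤-assoc (dy t) q

data StepOrder (i j : ℕ) (s : Step) (i′ j′ : ℕ) (s′ : Step) : Set where
  same-step    : i ≡ i′ → j ≡ j′ → s ≡ s′ → StepOrder i j s i′ j′ s′
  earlier-step : i + dx s ≤ i′ → j + dy s ≤ j′ → StepOrder i j s i′ j′ s′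
  later-step   : i′ + dx s′ ≤ i → j′ + dy s′ ≤ j → StepOrder i j s i′ j′ s′

At-ordered : ∀ {A i j s i′ j′ s′} → At A i j s → At A i′ j′ s′ → StepOrder i j s i′ j′ s′
At-ordered now now = same-step refl refl refl
At-ordered {s ∷ R} now (later {i = i} {j} b) = earlier-step (m≤m+n (dx s) i) (m≤m+n (dy s) j)
At-ordered {s ∷ R} (later {i = i} {j} a) now = later-step (m≤m+n (dx s) i) (m≤m+n (dy s) j)
At-ordered {t ∷ R} (later {i = i} {j} a) (later {i = i′} {j′} b) with At-ordered a b
... | same-step p q r = same-step (cong (dx t +_) p) (cong (dy t +_) q) r
... | earlier-step p q = earlier-step (+-monoʳ-≤-assoc (dx t) p) (+-monoʳ-≤-assoc (dy t) q)
... | later-step p q = later-step (+-monoʳ-≤-assoc (dx t) p) (+-monoʳ-≤-assoc (dy t) q)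

At-uniqueˣ : ∀ {A i j s j′ s′} → At A i j s → At A i j′ s′ → dx s ≡ 1 → dx s′ ≡ 1 → j ≡ j′ × s ≡ s′
At-uniqueˣ {i = i} a b e e′ with At-ordered a b
... | same-step _ q r = q , r
... | earlier-step p _ = ⊥-elim (<-irrefl refl (subst (_≤ i) (trans (cong (i +_) e) (+-comm i 1)) p))
... | later-step p _ = ⊥-elim (<-irrefl refl (subst (_≤ i) (trans (cong (i +_) e′) (+-comm i 1)) p))

At-replicate-M : ∀ n k → k < n → At (replicate n M) k k M
At-replicate-M (suc n) zero _ = now
At-replicate-M (suc n) (suc k) (s≤s k<) = later (At-replicate-M n k k<)

At-replicate-D : ∀ n k → k < n → At (replicate n D) k 0 D
At-replicate-D (suc n) zero _ = now
At-replicate-D (suc n) (suc k) (s≤s k<) = later (At-replicate-D n k k<)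

module _ (X Y : List Sym) where

  costFrom : ℕ → ℕ → List Step → ℕ
  costFrom x y [] = 0
  costFrom x y (s ∷ R) = elemCost _≟Sym_ X Y (x , y , just s) + costFrom (x + dx s) (y + dy s) R

  costList-trace : ∀ x y A → costList _≟Sym_ X Y (trace x y A) ≡ costFrom x y A
  costList-trace x y [] = refl
  costList-trace x y (s ∷ A) = cong (elemCost _≟Sym_ X Y (x , y , just s) +_) (costList-trace (x + dx s) (y + dy s) A)

  ed≡costFrom : ∀ A → ed _≟Sym_ X Y A ≡ costFrom 0 0 A
  ed≡costFrom = costList-trace 0 0

  costFrom-++ : ∀ x y R₁ R₂ → costFrom x y (R₁ ++ R₂) ≡ costFrom x y R₁ + costFrom (x + sumX R₁) (y + sumY R₁) R₂
  costFrom-++ x y [] R₂ = cong₂ (λ p q → costFrom p q R₂) (sym (+-identityʳ x)) (sym (+-identityʳ y))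
  costFrom-++ x y (s ∷ R₁) R₂ = begin
    e + costFrom (x + dx s) (y + dy s) (R₁ ++ R₂)
      ≡⟨ cong (e +_) (costFrom-++ (x + dx s) (y + dy s) R₁ R₂) ⟩
    e + (costFrom (x + dx s) (y + dy s) R₁ + costFrom (x + dx s + sumX R₁) (y + dy s + sumY R₁) R₂)
      ≡⟨ +-assoc e _ _ ⟨
    e + costFrom (x + dx s) (y + dy s) R₁ + costFrom (x + dx s + sumX R₁) (y + dy s + sumY R₁) R₂
      ≡⟨ cong (e + costFrom (x + dx s) (y + dy s) R₁ +_)
              (cong₂ (λ p q → costFrom p q R₂) (+-assoc x (dx s) _) (+-assoc y (dy s) _)) ⟩
    e + costFrom (x + dx s) (y + dy s) R₁ + costFrom (x + (dx s + sumX R₁)) (y + (dy s + sumY R₁)) R₂ ∎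
    where
    e : ℕ
    e = elemCost _≟Sym_ X Y (x , y , just s)

  matchCost-≡ : ∀ x y → X ! x ≡ Y ! y → elemCost _≟Sym_ X Y (x , y , just M) ≡ 0
  matchCost-≡ x y e with MaybeP.≡-dec _≟Sym_ (X ! x) (Y ! y)
  ... | yes _ = refl
  ... | no ne = ⊥-elim (ne e)

  matchCost-≢ : ∀ x y → X ! x ≢ Y ! y → elemCost _≟Sym_ X Y (x , y , just M) ≡ 1
  matchCost-≢ x y ne with MaybeP.≡-dec _≟Sym_ (X ! x) (Y ! y)
  ... | yes e = ⊥-elim (ne e)
  ... | no _ = refl

  sumY≤costFrom+sumX : ∀ x y R → sumY R ≤ costFrom x y R + sumX R
  sumY≤costFrom+sumX x y [] = z≤n
  sumY≤costFrom+sumX x y (D ∷ R) = ≤-trans (sumY≤costFrom+sumX (x + 1) (y + 0) R) (+-mono-≤ (n≤1+n _) (n≤1+n _))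
  sumY≤costFrom+sumX x y (I ∷ R) = s≤s (sumY≤costFrom+sumX (x + 0) (y + 1) R)
  sumY≤costFrom+sumX x y (M ∷ R) = ≤-trans (s≤s (sumY≤costFrom+sumX (x + 1) (y + 1) R))
    (≤-trans (≤-reflexive (sym (+-suc _ (sumX R)))) (+-monoˡ-≤ (suc (sumX R)) (m≤n+m _ _)))

  sumX≤costFrom+sumY : ∀ x y R → sumX R ≤ costFrom x y R + sumY R
  sumX≤costFrom+sumY x y [] = z≤n
  sumX≤costFrom+sumY x y (D ∷ R) = s≤s (sumX≤costFrom+sumY (x + 1) (y + 0) R)
  sumX≤costFrom+sumY x y (I ∷ R) = ≤-trans (sumX≤costFrom+sumY (x + 0) (y + 1) R) (+-mono-≤ (n≤1+n _) (n≤1+n _))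
  sumX≤costFrom+sumY x y (M ∷ R) = ≤-trans (s≤s (sumX≤costFrom+sumY (x + 1) (y + 1) R))
    (≤-trans (≤-reflexive (sym (+-suc _ (sumY R)))) (+-monoˡ-≤ (suc (sumY R)) (m≤n+m _ _)))

  costFrom-diagonal : ∀ x y n → (∀ k → k < n → X ! (x + k) ≡ Y ! (y + k)) → costFrom x y (replicate n M) ≡ 0
  costFrom-diagonal x y zero _ = refl
  costFrom-diagonal x y (suc n) agree = cong₂ _+_
    (matchCost-≡ x y (subst₂ (λ p q → X ! p ≡ Y ! q) (+-identityʳ x) (+-identityʳ y) (agree 0 (s≤s z≤n))))
    (costFrom-diagonal (x + 1) (y + 1) n
      (λ k k< → subst₂ (λ p q → X ! p ≡ Y ! q) (sym (+-assoc x 1 k)) (sym (+-assoc y 1 k)) (agree (suc k) (s≤s k<))))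

-- Restricting an alignment to a rectangle

-- restrictFrom i j R aligns the two strings with their first i and j symbols dropped, and
-- restrictTo a b R their first a and b symbols, as R does; a match leaving the rectangle becomes an indel.
restrictFrom : ℕ → ℕ → List Step → List Step
restrictFrom i j [] = []
restrictFrom zero zero (s ∷ R) = s ∷ R
restrictFrom zero (suc j) (D ∷ R) = D ∷ restrictFrom zero (suc j) R
restrictFrom zero (suc j) (I ∷ R) = restrictFrom zero j R
restrictFrom zero (suc j) (M ∷ R) = D ∷ restrictFrom zero j R
restrictFrom (suc i) zero (D ∷ R) = restrictFrom i zero R
restrictFrom (suc i) zero (I ∷ R) = I ∷ restrictFrom (suc i) zero R
restrictFrom (suc i) zero (M ∷ R) = I ∷ restrictFrom i zero R
restrictFrom (suc i) (suc j) (D ∷ R) = restrictFrom i (suc j) R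
restrictFrom (suc i) (suc j) (I ∷ R) = restrictFrom (suc i) j R
restrictFrom (suc i) (suc j) (M ∷ R) = restrictFrom i j R

restrictTo : ℕ → ℕ → List Step → List Step
restrictTo a b [] = []
restrictTo zero zero (s ∷ R) = []
restrictTo zero (suc b) (D ∷ R) = restrictTo zero (suc b) R
restrictTo zero (suc b) (I ∷ R) = I ∷ restrictTo zero b R
restrictTo zero (suc b) (M ∷ R) = I ∷ restrictTo zero b R
restrictTo (suc a) zero (D ∷ R) = D ∷ restrictTo a zero R
restrictTo (suc a) zero (I ∷ R) = restrictTo (suc a) zero R
restrictTo (suc a) zero (M ∷ R) = D ∷ restrictTo a zero R
restrictTo (suc a) (suc b) (D ∷ R) = D ∷ restrictTo a (suc b) R
restrictTo (suc a) (suc b) (I ∷ R) = I ∷ restrictTo (suc a) b R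
restrictTo (suc a) (suc b) (M ∷ R) = M ∷ restrictTo a b R

restrictFrom-0-0 : ∀ R → restrictFrom 0 0 R ≡ R
restrictFrom-0-0 [] = refl
restrictFrom-0-0 (s ∷ R) = refl

restrictTo-exact : ∀ a b R → sumX R ≡ a → sumY R ≡ b → restrictTo a b R ≡ R
restrictTo-exact a b [] _ _ = refl
restrictTo-exact zero b (D ∷ R) () _
restrictTo-exact (suc a) zero (D ∷ R) ex ey = cong (D ∷_) (restrictTo-exact a zero R (suc-injective ex) ey)
restrictTo-exact (suc a) (suc b) (D ∷ R) ex ey = cong (D ∷_) (restrictTo-exact a (suc b) R (suc-injective ex) ey)
restrictTo-exact a zero (I ∷ R) _ ()
restrictTo-exact zero (suc b) (I ∷ R) ex ey = cong (I ∷_) (restrictTo-exact zero b R ex (suc-injective ey))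
restrictTo-exact (suc a) (suc b) (I ∷ R) ex ey = cong (I ∷_) (restrictTo-exact (suc a) b R ex (suc-injective ey))
restrictTo-exact zero _ (M ∷ R) () _
restrictTo-exact (suc a) zero (M ∷ R) _ ()
restrictTo-exact (suc a) (suc b) (M ∷ R) ex ey = cong (M ∷_) (restrictTo-exact a b R (suc-injective ex) (suc-injective ey))

sums-restrictFrom : ∀ i j R k l → sumX R ≡ i + k → sumY R ≡ j + l → sumX (restrictFrom i j R) ≡ k × sumY (restrictFrom i j R) ≡ l
sums-restrictFrom i j [] k l ex ey = sym (m+n≡0⇒n≡0 i (sym ex)) , sym (m+n≡0⇒n≡0 j (sym ey))
sums-restrictFrom zero zero (s ∷ R) k l ex ey = ex , ey
sums-restrictFrom zero (suc j) (D ∷ R) zero l () ey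
sums-restrictFrom zero (suc j) (D ∷ R) (suc k) l ex ey = map₁ (cong suc) (sums-restrictFrom zero (suc j) R k l (suc-injective ex) ey)
sums-restrictFrom zero (suc j) (I ∷ R) k l ex ey = sums-restrictFrom zero j R k l ex (suc-injective ey)
sums-restrictFrom zero (suc j) (M ∷ R) zero l () ey
sums-restrictFrom zero (suc j) (M ∷ R) (suc k) l ex ey =
  map₁ (cong suc) (sums-restrictFrom zero j R k l (suc-injective ex) (suc-injective ey))
sums-restrictFrom (suc i) zero (D ∷ R) k l ex ey = sums-restrictFrom i zero R k l (suc-injective ex) ey
sums-restrictFrom (suc i) zero (I ∷ R) k zero ex ()
sums-restrictFrom (suc i) zero (I ∷ R) k (suc l) ex ey = map₂ (cong suc) (sums-restrictFrom (suc i) zero R k l ex (suc-injective ey))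
sums-restrictFrom (suc i) zero (M ∷ R) k zero ex ()
sums-restrictFrom (suc i) zero (M ∷ R) k (suc l) ex ey =
  map₂ (cong suc) (sums-restrictFrom i zero R k l (suc-injective ex) (suc-injective ey))
sums-restrictFrom (suc i) (suc j) (D ∷ R) k l ex ey = sums-restrictFrom i (suc j) R k l (suc-injective ex) ey
sums-restrictFrom (suc i) (suc j) (I ∷ R) k l ex ey = sums-restrictFrom (suc i) j R k l ex (suc-injective ey)
sums-restrictFrom (suc i) (suc j) (M ∷ R) k l ex ey = sums-restrictFrom i j R k l (suc-injective ex) (suc-injective ey)

sums-restrictTo : ∀ a b R i j → sumX R ≡ a + i → sumY R ≡ b + j → sumX (restrictTo a b R) ≡ a × sumY (restrictTo a b R) ≡ b
sums-restrictTo a b [] i j ex ey = sym (m+n≡0⇒m≡0 a (sym ex)) , sym (m+n≡0⇒m≡0 b (sym ey))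
sums-restrictTo zero zero (s ∷ R) i j ex ey = refl , refl
sums-restrictTo zero (suc b) (D ∷ R) zero j () ey
sums-restrictTo zero (suc b) (D ∷ R) (suc i) j ex ey = sums-restrictTo zero (suc b) R i j (suc-injective ex) ey
sums-restrictTo zero (suc b) (I ∷ R) i j ex ey = map₂ (cong suc) (sums-restrictTo zero b R i j ex (suc-injective ey))
sums-restrictTo zero (suc b) (M ∷ R) zero j () ey
sums-restrictTo zero (suc b) (M ∷ R) (suc i) j ex ey = map₂ (cong suc) (sums-restrictTo zero b R i j (suc-injective ex) (suc-injective ey))
sums-restrictTo (suc a) zero (D ∷ R) i j ex ey = map₁ (cong suc) (sums-restrictTo a zero R i j (suc-injective ex) ey)
sums-restrictTo (suc a) zero (I ∷ R) i zero ex ()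
sums-restrictTo (suc a) zero (I ∷ R) i (suc j) ex ey = sums-restrictTo (suc a) zero R i j ex (suc-injective ey)
sums-restrictTo (suc a) zero (M ∷ R) i zero ex ()
sums-restrictTo (suc a) zero (M ∷ R) i (suc j) ex ey = map₁ (cong suc) (sums-restrictTo a zero R i j (suc-injective ex) (suc-injective ey))
sums-restrictTo (suc a) (suc b) (D ∷ R) i j ex ey = map₁ (cong suc) (sums-restrictTo a (suc b) R i j (suc-injective ex) ey)
sums-restrictTo (suc a) (suc b) (I ∷ R) i j ex ey = map₂ (cong suc) (sums-restrictTo (suc a) b R i j ex (suc-injective ey))
sums-restrictTo (suc a) (suc b) (M ∷ R) i j ex ey =
  map× (cong suc) (cong suc) (sums-restrictTo a b R i j (suc-injective ex) (suc-injective ey))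




infix 4 _≤_+∣_−_∣
data _≤_+∣_−_∣ (a b i j : ℕ) : Set where
  via-i : a + j ≤ b + i → a ≤ b +∣ i − j ∣
  via-j : a + i ≤ b + j → a ≤ b +∣ i − j ∣

gap-refl : ∀ {a b i} → a ≤ b +∣ i − i ∣ → a ≤ b
gap-refl {i = i} (via-i p) = +-cancelʳ-≤ i _ _ p
gap-refl {i = i} (via-j p) = +-cancelʳ-≤ i _ _ p

gap-0ᵢ : ∀ {a b j} → a ≤ b +∣ 0 − j ∣ → a ≤ b + j
gap-0ᵢ {a} {b} {j} (via-i p) = ≤-trans (m≤m+n a j) (≤-trans p (≤-trans (≤-reflexive (+-identityʳ b)) (m≤m+n b j)))
gap-0ᵢ {a} {b} {j} (via-j p) = subst (_≤ b + j) (+-identityʳ a) p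

gap-0ⱼ : ∀ {a b i} → a ≤ b +∣ i − 0 ∣ → a ≤ b + i
gap-0ⱼ {a} {b} {i} (via-i p) = subst (_≤ b + i) (+-identityʳ a) p
gap-0ⱼ {a} {b} {i} (via-j p) = ≤-trans (m≤m+n a i) (≤-trans p (≤-trans (≤-reflexive (+-identityʳ b)) (m≤m+n b i)))

gap-suc : ∀ {a b i j} → a ≤ b +∣ i − j ∣ → suc a ≤ suc b +∣ i − j ∣
gap-suc (via-i p) = via-i (s≤s p)
gap-suc (via-j p) = via-j (s≤s p)

gap-+ : ∀ m {a b i j} → a ≤ b +∣ i − j ∣ → m + a ≤ m + b +∣ i − j ∣
gap-+ m {a} {b} {i} {j} (via-i p) = via-i (subst₂ _≤_ (sym (+-assoc m a j)) (sym (+-assoc m b i)) (+-monoʳ-≤ m p))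
gap-+ m {a} {b} {i} {j} (via-j p) = via-j (subst₂ _≤_ (sym (+-assoc m a i)) (sym (+-assoc m b j)) (+-monoʳ-≤ m p))

gap-sucᵢ : ∀ {a b i j} → a ≤ b +∣ i − j ∣ → a ≤ suc b +∣ suc i − j ∣
gap-sucᵢ {a} {b} {i} {j} (via-i p) = via-i (≤-trans p (+-mono-≤ (n≤1+n b) (n≤1+n i)))
gap-sucᵢ {a} {b} {i} {j} (via-j p) = via-j (≤-trans (≤-reflexive (+-suc a i)) (s≤s p))

gap-sucⱼ : ∀ {a b i j} → a ≤ b +∣ i − j ∣ → a ≤ suc b +∣ i − suc j ∣
gap-sucⱼ {a} {b} {i} {j} (via-i p) = via-i (≤-trans (≤-reflexive (+-suc a j)) (s≤s p))
gap-sucⱼ {a} {b} {i} {j} (via-j p) = via-j (≤-trans p (+-mono-≤ (n≤1+n b) (n≤1+n j)))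

suc-≤-+-suc : ∀ m {x b k} → x ≤ b + k → suc x ≤ m + b + suc k
suc-≤-+-suc m {x} {b} {k} p = ≤-trans (s≤s p) (≤-trans (≤-reflexive (sym (+-suc b k))) (+-monoˡ-≤ (suc k) (m≤n+m b m)))

gap-suc-both : ∀ m {a b i j} → a ≤ b +∣ i − j ∣ → a ≤ m + b +∣ suc i − suc j ∣
gap-suc-both m {a} {b} {i} {j} (via-i p) = via-i (subst (_≤ m + b + suc i) (sym (+-suc a j)) (suc-≤-+-suc m p))
gap-suc-both m {a} {b} {i} {j} (via-j p) = via-j (subst (_≤ m + b + suc j) (sym (+-suc a i)) (suc-≤-+-suc m p))

gap-0-sucⱼ : ∀ m {a b j} → a ≤ b +∣ 0 − j ∣ → suc a ≤ m + b +∣ 0 − suc j ∣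
gap-0-sucⱼ m {a} {b} {j} g =
  via-j (subst (_≤ m + b + suc j) (sym (+-identityʳ (suc a))) (suc-≤-+-suc m (gap-0ᵢ g)))

gap-0-sucᵢ : ∀ m {a b i} → a ≤ b +∣ i − 0 ∣ → suc a ≤ m + b +∣ suc i − 0 ∣
gap-0-sucᵢ m {a} {b} {i} g =
  via-i (subst (_≤ m + b + suc i) (sym (+-identityʳ (suc a))) (suc-≤-+-suc m (gap-0ⱼ g)))

absorb : ∀ {p′} p d i → p′ ≡ p + (d + i) → p′ ≡ p + d + i
absorb p d i e = trans e (sym (+-assoc p d i))

shift : ∀ {p′} p d i → p′ ≡ p + i → p′ + d ≡ p + d + i
shift p d i e = trans (cong (_+ d) e) (trans (+-assoc p i d) (trans (cong (p +_) (+-comm i d)) (sym (+-assoc p d i))))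

module _ (X Y : List Sym) where

  private
    cost : ℕ → ℕ → List Step → ℕ
    cost = costFrom X Y

  cost-restrictFrom : ∀ i j p q p′ q′ R → p′ ≡ p + i → q′ ≡ q + j → cost p′ q′ (restrictFrom i j R) ≤ cost p q R +∣ i − j ∣
  cost-restrictFrom i j p q p′ q′ [] _ _ with ≤-total j i
  ... | inj₁ j≤i = via-i j≤i
  ... | inj₂ i≤j = via-j i≤j
  cost-restrictFrom zero zero p q p′ q′ (s ∷ R) refl refl =
    via-i (≤-reflexive (cong₂ (λ a b → cost a b (s ∷ R) + 0) (+-identityʳ p) (+-identityʳ q)))
  cost-restrictFrom zero (suc j) p q p′ q′ (D ∷ R) ep eq =
    gap-suc (cost-restrictFrom zero (suc j) (p + 1) (q + 0) (p′ + 1) (q′ + 0) R (shift p 1 0 ep) (shift q 0 (suc j) eq))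
  cost-restrictFrom zero (suc j) p q p′ q′ (I ∷ R) ep eq =
    gap-sucⱼ (cost-restrictFrom zero j (p + 0) (q + 1) p′ q′ R (absorb p 0 0 ep) (absorb q 1 j eq))
  cost-restrictFrom zero (suc j) p q p′ q′ (M ∷ R) ep eq =
    gap-0-sucⱼ (elemCost _≟Sym_ X Y (p , q , just M))
      (cost-restrictFrom zero j (p + 1) (q + 1) (p′ + 1) (q′ + 0) R (shift p 1 0 ep) (trans (+-identityʳ q′) (absorb q 1 j eq)))
  cost-restrictFrom (suc i) zero p q p′ q′ (D ∷ R) ep eq =
    gap-sucᵢ (cost-restrictFrom i zero (p + 1) (q + 0) p′ q′ R (absorb p 1 i ep) (absorb q 0 0 eq))
  cost-restrictFrom (suc i) zero p q p′ q′ (I ∷ R) ep eq =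
    gap-suc (cost-restrictFrom (suc i) zero (p + 0) (q + 1) (p′ + 0) (q′ + 1) R (shift p 0 (suc i) ep) (shift q 1 0 eq))
  cost-restrictFrom (suc i) zero p q p′ q′ (M ∷ R) ep eq =
    gap-0-sucᵢ (elemCost _≟Sym_ X Y (p , q , just M))
      (cost-restrictFrom i zero (p + 1) (q + 1) (p′ + 0) (q′ + 1) R (trans (+-identityʳ p′) (absorb p 1 i ep)) (shift q 1 0 eq))
  cost-restrictFrom (suc i) (suc j) p q p′ q′ (D ∷ R) ep eq =
    gap-sucᵢ (cost-restrictFrom i (suc j) (p + 1) (q + 0) p′ q′ R (absorb p 1 i ep) (absorb q 0 (suc j) eq))
  cost-restrictFrom (suc i) (suc j) p q p′ q′ (I ∷ R) ep eq =
    gap-sucⱼ (cost-restrictFrom (suc i) j (p + 0) (q + 1) p′ q′ R (absorb p 0 (suc i) ep) (absorb q 1 j eq))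
  cost-restrictFrom (suc i) (suc j) p q p′ q′ (M ∷ R) ep eq =
    gap-suc-both (elemCost _≟Sym_ X Y (p , q , just M)) (cost-restrictFrom i j (p + 1) (q + 1) p′ q′ R (absorb p 1 i ep) (absorb q 1 j eq))

  cost-restrictTo-0ᵢ : ∀ b R p q p′ q′ i j → sumX R ≡ i → sumY R ≡ b + j → cost p′ q′ (restrictTo 0 b R) + j ≤ cost p q R + i
  cost-restrictTo-0ᵢ b [] p q p′ q′ i j ex ey with m+n≡0⇒n≡0 b (sym ey)
  ... | refl = z≤n
  cost-restrictTo-0ᵢ zero (s ∷ R) p q p′ q′ i j ex ey =
    subst₂ (λ a b′ → a ≤ cost p q (s ∷ R) + b′) ey ex (sumY≤costFrom+sumX X Y p q (s ∷ R))
  cost-restrictTo-0ᵢ (suc b) (D ∷ R) p q p′ q′ zero j () ey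
  cost-restrictTo-0ᵢ (suc b) (D ∷ R) p q p′ q′ (suc i) j ex ey =
    ≤-trans (cost-restrictTo-0ᵢ (suc b) R (p + 1) (q + 0) p′ q′ i j (suc-injective ex) ey) (+-mono-≤ (n≤1+n _) (n≤1+n i))
  cost-restrictTo-0ᵢ (suc b) (I ∷ R) p q p′ q′ i j ex ey =
    s≤s (cost-restrictTo-0ᵢ b R (p + 0) (q + 1) (p′ + 0) (q′ + 1) i j ex (suc-injective ey))
  cost-restrictTo-0ᵢ (suc b) (M ∷ R) p q p′ q′ zero j () ey
  cost-restrictTo-0ᵢ (suc b) (M ∷ R) p q p′ q′ (suc i) j ex ey =
    suc-≤-+-suc _ (cost-restrictTo-0ᵢ b R (p + 1) (q + 1) (p′ + 0) (q′ + 1) i j (suc-injective ex) (suc-injective ey))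

  cost-restrictTo-0ⱼ : ∀ a R p q p′ q′ i j → sumX R ≡ a + i → sumY R ≡ j → cost p′ q′ (restrictTo a 0 R) + i ≤ cost p q R + j
  cost-restrictTo-0ⱼ a [] p q p′ q′ i j ex ey with m+n≡0⇒n≡0 a (sym ex)
  ... | refl = z≤n
  cost-restrictTo-0ⱼ zero (s ∷ R) p q p′ q′ i j ex ey =
    subst₂ (λ a b′ → a ≤ cost p q (s ∷ R) + b′) ex ey (sumX≤costFrom+sumY X Y p q (s ∷ R))
  cost-restrictTo-0ⱼ (suc a) (D ∷ R) p q p′ q′ i j ex ey =
    s≤s (cost-restrictTo-0ⱼ a R (p + 1) (q + 0) (p′ + 1) (q′ + 0) i j (suc-injective ex) ey)
  cost-restrictTo-0ⱼ (suc a) (I ∷ R) p q p′ q′ i zero ex ()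
  cost-restrictTo-0ⱼ (suc a) (I ∷ R) p q p′ q′ i (suc j) ex ey =
    ≤-trans (cost-restrictTo-0ⱼ (suc a) R (p + 0) (q + 1) p′ q′ i j ex (suc-injective ey)) (+-mono-≤ (n≤1+n _) (n≤1+n j))
  cost-restrictTo-0ⱼ (suc a) (M ∷ R) p q p′ q′ i zero ex ()
  cost-restrictTo-0ⱼ (suc a) (M ∷ R) p q p′ q′ i (suc j) ex ey =
    suc-≤-+-suc _ (cost-restrictTo-0ⱼ a R (p + 1) (q + 1) (p′ + 1) (q′ + 0) i j (suc-injective ex) (suc-injective ey))

  cost-restrictTo : ∀ a b R p q i j → sumX R ≡ a + i → sumY R ≡ b + j → cost p q (restrictTo a b R) ≤ cost p q R +∣ i − j ∣
  cost-restrictTo zero b R p q i j ex ey = via-i (cost-restrictTo-0ᵢ b R p q p q i j ex ey)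
  cost-restrictTo (suc a) zero R p q i j ex ey = via-j (cost-restrictTo-0ⱼ (suc a) R p q p q i j ex ey)
  cost-restrictTo (suc a) (suc b) (D ∷ R) p q i j ex ey =
    gap-suc (cost-restrictTo a (suc b) R (p + 1) (q + 0) i j (suc-injective ex) ey)
  cost-restrictTo (suc a) (suc b) (I ∷ R) p q i j ex ey =
    gap-suc (cost-restrictTo (suc a) b R (p + 0) (q + 1) i j ex (suc-injective ey))
  cost-restrictTo (suc a) (suc b) (M ∷ R) p q i j ex ey =
    gap-+ (elemCost _≟Sym_ X Y (p , q , just M)) (cost-restrictTo a b R (p + 1) (q + 1) i j (suc-injective ex) (suc-injective ey))

  cost-restrictFrom-0-1 : ∀ R p q q′ → q′ ≡ q + 1 → (∀ i → At R i 0 M → X ! (p + i) ≢ Y ! q) →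
    cost p q′ (restrictFrom 0 1 R) ≤ cost p q R
  cost-restrictFrom-0-1 [] p q q′ e unmatched = z≤n
  cost-restrictFrom-0-1 (D ∷ R) p q q′ e unmatched =
    s≤s (cost-restrictFrom-0-1 R (p + 1) (q + 0) (q′ + 0) (shift q 0 1 e)
      (λ i at → subst₂ (λ x y → X ! x ≢ Y ! y) (sym (+-assoc p 1 i)) (sym (+-identityʳ q)) (unmatched (suc i) (later at))))
  cost-restrictFrom-0-1 (I ∷ R) p q q′ e unmatched =
    ≤-trans (≤-reflexive (trans (cong (cost p q′) (restrictFrom-0-0 R)) (cong₂ (λ a b → cost a b R) (sym (+-identityʳ p)) e))) (n≤1+n _)
  cost-restrictFrom-0-1 (M ∷ R) p q q′ e unmatched = ≤-reflexive (cong₂ _+_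
    (sym (matchCost-≢ X Y p q (subst (λ x → X ! x ≢ Y ! q) (+-identityʳ p) (unmatched 0 now))))
    (trans (cong (cost (p + 1) (q′ + 0)) (restrictFrom-0-0 R)) (cong (λ y → cost (p + 1) y R) (trans (+-identityʳ q′) e))))

  cost-restrictFrom-1-0 : ∀ R p q p′ → p′ ≡ p + 1 → (∀ j → At R 0 j M → X ! p ≢ Y ! (q + j)) →
    cost p′ q (restrictFrom 1 0 R) ≤ cost p q R
  cost-restrictFrom-1-0 [] p q p′ e unmatched = z≤n
  cost-restrictFrom-1-0 (I ∷ R) p q p′ e unmatched =
    s≤s (cost-restrictFrom-1-0 R (p + 0) (q + 1) (p′ + 0) (shift p 0 1 e)
      (λ j at → subst₂ (λ x y → X ! x ≢ Y ! y) (sym (+-identityʳ p)) (sym (+-assoc q 1 j)) (unmatched (suc j) (later at))))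
  cost-restrictFrom-1-0 (D ∷ R) p q p′ e unmatched =
    ≤-trans (≤-reflexive (trans (cong (cost p′ q) (restrictFrom-0-0 R)) (cong₂ (λ a b → cost a b R) e (sym (+-identityʳ q))))) (n≤1+n _)
  cost-restrictFrom-1-0 (M ∷ R) p q p′ e unmatched = ≤-reflexive (cong₂ _+_
    (sym (matchCost-≢ X Y p q (subst (λ y → X ! p ≢ Y ! y) (+-identityʳ q) (unmatched 0 now))))
    (trans (cong (cost (p′ + 0) (q + 1)) (restrictFrom-0-0 R)) (cong (λ x → cost x (q + 1) R) (trans (+-identityʳ p′) e))))

∃-later : ∀ {s R i s′} → ∃ (λ j → At R i j s′) → ∃ (λ j → At (s ∷ R) (dx s + i) j s′)
∃-later (j , a) = _ , later a

restrictTo-D : ∀ {R i j} a b → At R i j D → i < a → Σ ℕ λ j′ → At (restrictTo a b R) i j′ D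
restrictTo-D zero b x ()
restrictTo-D (suc a) zero now p = 0 , now
restrictTo-D (suc a) (suc b) now p = 0 , now
restrictTo-D (suc a) zero (later {s = D} x) (s≤s p) = ∃-later (restrictTo-D a zero x p)
restrictTo-D (suc a) zero (later {s = I} x) p = restrictTo-D (suc a) zero x p
restrictTo-D (suc a) zero (later {s = M} x) (s≤s p) = ∃-later (restrictTo-D a zero x p)
restrictTo-D (suc a) (suc b) (later {s = D} x) (s≤s p) = ∃-later (restrictTo-D a (suc b) x p)
restrictTo-D (suc a) (suc b) (later {s = I} x) p = ∃-later (restrictTo-D (suc a) b x p)
restrictTo-D (suc a) (suc b) (later {s = M} x) (s≤s p) = ∃-later (restrictTo-D a b x p)

restrictTo-M : ∀ {R i j} a b → At R i j M → i < a → j < b → At (restrictTo a b R) i j M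
restrictTo-M zero b x () q
restrictTo-M (suc a) zero x p ()
restrictTo-M (suc a) (suc b) now p q = now
restrictTo-M (suc a) (suc b) (later {s = D} x) (s≤s p) q = later (restrictTo-M a (suc b) x p q)
restrictTo-M (suc a) (suc b) (later {s = I} x) p (s≤s q) = later (restrictTo-M (suc a) b x p q)
restrictTo-M (suc a) (suc b) (later {s = M} x) (s≤s p) (s≤s q) = later (restrictTo-M a b x p q)

restrictTo-M⇒D : ∀ {R i j} a b → At R i j M → i < a → b ≤ j → Σ ℕ λ j′ → At (restrictTo a b R) i j′ D
restrictTo-M⇒D zero b x () q
restrictTo-M⇒D (suc a) zero now p q = 0 , now
restrictTo-M⇒D (suc a) (suc b) now p ()
restrictTo-M⇒D (suc a) zero (later {s = D} x) (s≤s p) q = ∃-later (restrictTo-M⇒D a zero x p z≤n)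
restrictTo-M⇒D (suc a) zero (later {s = I} x) p q = restrictTo-M⇒D (suc a) zero x p z≤n
restrictTo-M⇒D (suc a) zero (later {s = M} x) (s≤s p) q = ∃-later (restrictTo-M⇒D a zero x p z≤n)
restrictTo-M⇒D (suc a) (suc b) (later {s = D} x) (s≤s p) q = ∃-later (restrictTo-M⇒D a (suc b) x p q)
restrictTo-M⇒D (suc a) (suc b) (later {s = I} x) p (s≤s q) = ∃-later (restrictTo-M⇒D (suc a) b x p q)
restrictTo-M⇒D (suc a) (suc b) (later {s = M} x) (s≤s p) (s≤s q) = ∃-later (restrictTo-M⇒D a b x p q)

restrictFrom-D : ∀ {R I j} i0 j0 i → At R I j D → I ≡ i0 + i → Σ ℕ λ j′ → At (restrictFrom i0 j0 R) i j′ D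
restrictFrom-D {s ∷ R′} {j = j} zero zero i x e = j , subst (λ z → At (s ∷ R′) z j D) e x
restrictFrom-D zero (suc j0) i now e = 0 , subst (λ z → At _ z 0 D) e now
restrictFrom-D zero (suc j0) i (later {s =
  D} {i = I′} x) e = subst (λ z → ∃ λ j → At _ z j D) e (∃-later (restrictFrom-D zero (suc j0) I′ x refl))
restrictFrom-D zero (suc j0) i (later {s = I} x) e = restrictFrom-D zero j0 i x e
restrictFrom-D zero (suc j0) i (later {s =
  M} {i = I′} x) e = subst (λ z → ∃ λ j → At _ z j D) e (∃-later (restrictFrom-D zero j0 I′ x refl))
restrictFrom-D (suc i0) zero i now ()
restrictFrom-D (suc i0) zero i (later {s = D} x) e = restrictFrom-D i0 zero i x (suc-injective e)
restrictFrom-D (suc i0) zero i (later {s = I} x) e = ∃-later (restrictFrom-D (suc i0) zero i x e)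
restrictFrom-D (suc i0) zero i (later {s = M} x) e = ∃-later (restrictFrom-D i0 zero i x (suc-injective e))
restrictFrom-D (suc i0) (suc j0) i now ()
restrictFrom-D (suc i0) (suc j0) i (later {s = D} x) e = restrictFrom-D i0 (suc j0) i x (suc-injective e)
restrictFrom-D (suc i0) (suc j0) i (later {s = I} x) e = restrictFrom-D (suc i0) j0 i x e
restrictFrom-D (suc i0) (suc j0) i (later {s = M} x) e = restrictFrom-D i0 j0 i x (suc-injective e)

restrictFrom-M : ∀ {R I J} i0 j0 i j → At R I J M → I ≡ i0 + i → J ≡ j0 + j → At (restrictFrom i0 j0 R) i j M
restrictFrom-M {s ∷ R′} zero zero i j x eI eJ = subst₂ (λ a b → At (s ∷ R′) a b M) eI eJ x
restrictFrom-M zero (suc j0) i j now eI ()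
restrictFrom-M zero (suc j0) i j (later {s =
  D} {i = I′} x) eI eJ = subst (λ z → At _ z j M) eI (later (restrictFrom-M zero (suc j0) I′ j x refl eJ))
restrictFrom-M zero (suc j0) i j (later {s = I} x) eI eJ = restrictFrom-M zero j0 i j x eI (suc-injective eJ)
restrictFrom-M zero (suc j0) i j (later {s =
  M} {i = I′} x) eI eJ = subst (λ z → At _ z j M) eI (later (restrictFrom-M zero j0 I′ j x refl (suc-injective eJ)))
restrictFrom-M (suc i0) zero i j now () eJ
restrictFrom-M (suc i0) zero i j (later {s = D} x) eI eJ = restrictFrom-M i0 zero i j x (suc-injective eI) eJ
restrictFrom-M (suc i0) zero i j (later {s =
  I} {j = J′} x) eI eJ = subst (λ z → At _ i z M) eJ (later (restrictFrom-M (suc i0) zero i J′ x eI refl))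
restrictFrom-M (suc i0) zero i j (later {s =
  M} {j = J′} x) eI eJ = subst (λ z → At _ i z M) eJ (later (restrictFrom-M i0 zero i J′ x (suc-injective eI) refl))
restrictFrom-M (suc i0) (suc j0) i j now () eJ
restrictFrom-M (suc i0) (suc j0) i j (later {s = D} x) eI eJ = restrictFrom-M i0 (suc j0) i j x (suc-injective eI) eJ
restrictFrom-M (suc i0) (suc j0) i j (later {s = I} x) eI eJ = restrictFrom-M (suc i0) j0 i j x eI (suc-injective eJ)
restrictFrom-M (suc i0) (suc j0) i j (later {s = M} x) eI eJ = restrictFrom-M i0 j0 i j x (suc-injective eI) (suc-injective eJ)

restrictFrom-M⇒D : ∀ {R I J} i0 j0 i → At R I J M → I ≡ i0 + i → J < j0 → Σ ℕ λ j′ → At (restrictFrom i0 j0 R) i j′ D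
restrictFrom-M⇒D i0 zero i x eI ()
restrictFrom-M⇒D zero (suc j0) i now eI l′ = 0 , subst (λ z → At _ z 0 D) eI now
restrictFrom-M⇒D zero (suc j0) i (later {s =
  D} {i = I′} x) eI l′ = subst (λ z → ∃ λ j → At _ z j D) eI (∃-later (restrictFrom-M⇒D zero (suc j0) I′ x refl l′))
restrictFrom-M⇒D zero (suc j0) i (later {s = I} x) eI (s≤s l′) = restrictFrom-M⇒D zero j0 i x eI l′
restrictFrom-M⇒D zero (suc j0) i (later {s =
  M} {i = I′} x) eI (s≤s l′) = subst (λ z → ∃ λ j → At _ z j D) eI (∃-later (restrictFrom-M⇒D zero j0 I′ x refl l′))
restrictFrom-M⇒D (suc i0) (suc j0) i now () l′
restrictFrom-M⇒D (suc i0) (suc j0) i (later {s = D} x) eI l′ = restrictFrom-M⇒D i0 (suc j0) i x (suc-injective eI) l′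
restrictFrom-M⇒D (suc i0) (suc j0) i (later {s = I} x) eI (s≤s l′) = restrictFrom-M⇒D (suc i0) j0 i x eI l′
restrictFrom-M⇒D (suc i0) (suc j0) i (later {s = M} x) eI (s≤s l′) = restrictFrom-M⇒D i0 j0 i x (suc-injective eI) l′




-- Splicing the diagonal through equal subtrees

module Splice (F G : Forest) (lab lab^ : Labeling F G) (h : ℕ) (hF : height F ≤ h) (hG : height G ≤ h)
              (look-ahead : IsLookAhead F G lab h lab^)
              (u : Node F) (v : Node G) (u≈v : lab^ (inj₁ u) ≡ lab^ (inj₂ v)) where

  same-subtree : PlSub h F (lab ∘ inj₁) u ≡ PlSub h G (lab ∘ inj₂) v
  same-subtree = Equivalence.to (look-ahead (inj₁ u) (inj₂ v)) u≈v

  open Counterparts (lab ∘ inj₁) (lab ∘ inj₂) hF hG same-subtree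

  W : ℕ
  W = width u

  suc-c-u : suc (c u) ≡ o u + W
  suc-c-u = suc-c≡o+width u

  suc-c-v : suc (c v) ≡ o v + W
  suc-c-v = trans (suc-c≡o+width v) (cong (o v +_) (sym width-≡))

  Matches-counterparts : Labeling F G → Set
  Matches-counterparts κ = ∀ a (oa≥ : o u ≤ o a) (ca≤ : c a ≤ c u) → κ (inj₁ a) ≡ κ (inj₂ (Counterpart.b (counterpart a oa≥ ca≤)))

  lab-matches : Matches-counterparts lab
  lab-matches a oa≥ ca≤ = Counterpart.label-≡ (counterpart a oa≥ ca≤)

  lab^-matches : Matches-counterparts lab^
  lab^-matches a oa≥ ca≤ = Equivalence.from (look-ahead _ _) (Counterpart.PlSub-≡ (counterpart a oa≥ ca≤))

  inside-block : ∀ {k z} → k < W → z ≡ o u + k → ¬ Outside u z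
  inside-block {k} k<W refl (inj₁ z<ou) = <⇒≱ z<ou (m≤m+n (o u) k)
  inside-block {k} k<W refl (inj₂ cu<z) = <⇒≱ (+-monoʳ-< (o u) k<W) (subst (_≤ o u + k) suc-c-u cu<z)

  block-agrees : ∀ κ → Matches-counterparts κ → ∀ k → k < W → PlF F G κ ! (o u + k) ≡ PlG F G κ ! (o v + k)
  block-agrees κ matches k k<W
    with parenthesisAt F (o u + k) (≤-trans (subst (suc (o u + k) ≤_) (sym suc-c-u) (+-monoʳ-< (o u) k<W)) (c<2*size u))
  ... | a , at with nesting u a | at
  ...   | unrelated oa∉ _ | inj₁ oa≡ = ⊥-elim (inside-block k<W oa≡ oa∉)
  ...   | unrelated _ ca∉ | inj₂ ca≡ = ⊥-elim (inside-block k<W ca≡ ca∉)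
  ...   | descendant oa≥ ca≤ | inj₁ oa≡ =
    subst₂ (λ p q → PlF F G κ ! p ≡ PlG F G κ ! q) oa≡ (trans o-b (cong (o v +_) (+-cancelˡ-≡ (o u) i k (trans (sym o-a) oa≡))))
           (proj₁ (Pl-!-matching κ (matches a oa≥ ca≤)))
    where open Counterpart (counterpart a oa≥ ca≤)
  ...   | descendant oa≥ ca≤ | inj₂ ca≡ =
    subst₂ (λ p q → PlF F G κ ! p ≡ PlG F G κ ! q) ca≡ (trans c-b (cong (o v +_) (+-cancelˡ-≡ (o u) j k (trans (sym c-a) ca≡))))
           (proj₂ (Pl-!-matching κ (matches a oa≥ ca≤)))
    where open Counterpart (counterpart a oa≥ ca≤)

  OffBlock : ℕ → ℕ → Set
  OffBlock x₀ z = z < x₀ ⊎ x₀ + W ≤ z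

  offBlockˣ : ∀ {z} → Outside u z → OffBlock (o u) z
  offBlockˣ (inj₁ p) = inj₁ p
  offBlockˣ {z} (inj₂ p) = inj₂ (subst (_≤ z) suc-c-u p)

  offBlockʸ : ∀ {z} → Outside v z → OffBlock (o v) z
  offBlockʸ (inj₁ p) = inj₁ p
  offBlockʸ {z} (inj₂ p) = inj₂ (subst (_≤ z) suc-c-v p)

  sumX-diagonal : sumX (replicate W M) ≡ W
  sumX-diagonal = trans (sumX-replicate W M) (*-identityʳ W)

  sumY-diagonal : sumY (replicate W M) ≡ W
  sumY-diagonal = trans (sumY-replicate W M) (*-identityʳ W)

  module Spliced (A₁ A₂ : List Step) (k r : ℕ) (W≡k+r : W ≡ k + r)
                 (sumX-A₁ : sumX A₁ ≡ o u + k) (sumY-A₁ : sumY A₁ ≡ o v + k) where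

    prefix suffix spliced : List Step
    prefix = restrictTo (o u) (o v) A₁
    suffix = restrictFrom r r A₂
    spliced = prefix ++ (replicate W M ++ suffix)

    sums-prefix : sumX prefix ≡ o u × sumY prefix ≡ o v
    sums-prefix = sums-restrictTo (o u) (o v) A₁ k k sumX-A₁ sumY-A₁

    k≤W : k ≤ W
    k≤W = subst (k ≤_) (sym W≡k+r) (m≤m+n k r)

    block-end≡ : ∀ x₀ → x₀ + W ≡ x₀ + k + r
    block-end≡ x₀ = trans (cong (x₀ +_) W≡k+r) (sym (+-assoc x₀ k r))

    At-prefix : ∀ {z w s} → At prefix z w s → At spliced z w s
    At-prefix = At-++ˡ _

    At-suffix : ∀ {z w s} → At suffix z w s → At spliced (o u + (W + z)) (o v + (W + w)) s
    At-suffix {z} {w} {s} a = subst₂ (λ p q → At spliced p q s)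
      (cong₂ _+_ (proj₁ sums-prefix) (cong (_+ z) sumX-diagonal))
      (cong₂ _+_ (proj₂ sums-prefix) (cong (_+ w) sumY-diagonal))
      (At-++ʳ prefix (At-++ʳ (replicate W M) a))

    At-block : ∀ i → i < W → At spliced (o u + i) (o v + i) M
    At-block i i<W = subst₂ (λ p q → At spliced p q M) (cong (_+ i) (proj₁ sums-prefix)) (cong (_+ i) (proj₂ sums-prefix))
      (At-++ʳ prefix (At-++ˡ suffix (At-replicate-M W i i<W)))

    past-block : ∀ {x₀ z z′ S} → S ≡ x₀ + k → z ≡ S + z′ → x₀ + W ≤ z →
      ∃ λ z″ → z′ ≡ r + z″ × z ≡ x₀ + (W + z″)
    past-block {x₀} {z} {z′} refl refl W≤z =
      let r≤z′ = +-cancelˡ-≤ (x₀ + k) r z′ (subst (_≤ x₀ + k + z′) (block-end≡ x₀) W≤z)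
          (z″ , r+z″≡) = m≤n⇒∃[o]m+o≡n r≤z′
      in z″ , sym r+z″≡ ,
         trans (cong (x₀ + k +_) (sym r+z″≡)) (trans (regroup x₀ k r z″) (cong (λ t → x₀ + (t + z″)) (sym W≡k+r)))
      where
      regroup : ∀ a k r z → a + k + (r + z) ≡ a + (k + r + z)
      regroup = solve-∀

    before-block : ∀ {x₀ z S} → S ≡ x₀ + k → z + 1 ≤ S → OffBlock x₀ z → z < x₀
    before-block _ _ (inj₁ z<x₀) = z<x₀
    before-block {x₀} {z} refl z+1≤ (inj₂ W≤z) =
      ⊥-elim (<⇒≱ (≤-trans (subst (_≤ x₀ + k) (+-comm z 1) z+1≤) (+-monoʳ-≤ x₀ k≤W)) W≤z)

    beyond-block : ∀ {x₀ z z′ S} → S ≡ x₀ + k → z ≡ S + z′ → OffBlock x₀ z →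
      ∃ λ z″ → z′ ≡ r + z″ × z ≡ x₀ + (W + z″)
    beyond-block {x₀} {z′ = z′} refl refl (inj₁ z<x₀) = ⊥-elim (<⇒≱ z<x₀ (≤-trans (m≤m+n x₀ k) (m≤m+n (x₀ + k) z′)))
    beyond-block S≡ z≡ (inj₂ W≤z) = past-block S≡ z≡ W≤z

    first-step-bounds : ∀ {z w s} → At A₁ z w s → z + dx s ≤ o u + k × w + dy s ≤ o v + k
    first-step-bounds a = let (p , q) = At-bounded a in subst (_ ≤_) sumX-A₁ p , subst (_ ≤_) sumY-A₁ q

    spliced-D : ∀ {z j} → OffBlock (o u) z → At (A₁ ++ A₂) z j D → ∃ λ j′ → At spliced z j′ D
    spliced-D oz a with At-++⁻ A₁ a
    ... | inj₁ a₁ = map₂ At-prefix (restrictTo-D (o u) (o v) a₁ (before-block refl (proj₁ (first-step-bounds a₁)) oz))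
    ... | inj₂ (z′ , _ , a₂ , ez , _) =
      let (z″ , e₁ , e₂) = beyond-block sumX-A₁ ez oz
          (j′ , a′) = restrictFrom-D r r z″ a₂ e₁
      in o v + (W + j′) , subst (λ t → At spliced t (o v + (W + j′)) D) (sym e₂) (At-suffix a′)

    spliced-M : ∀ {z w} → OffBlock (o u) z → OffBlock (o v) w → At (A₁ ++ A₂) z w M → At spliced z w M
    spliced-M oz ow a with At-++⁻ A₁ a
    ... | inj₁ a₁ = let (bx , by) = first-step-bounds a₁
                    in At-prefix (restrictTo-M (o u) (o v) a₁ (before-block refl bx oz) (before-block refl by ow))
    ... | inj₂ (z′ , w′ , a₂ , ez , ew) =
      let (z″ , e₁ , e₂) = beyond-block sumX-A₁ ez oz
          (w″ , f₁ , f₂) = beyond-block sumY-A₁ ew ow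
      in subst₂ (λ p q → At spliced p q M) (sym e₂) (sym f₂) (At-suffix (restrictFrom-M r r z″ w″ a₂ e₁ f₁))

    spliced-M⇒D : ∀ {z w} → OffBlock (o u) z → o v ≤ w → w < o v + W → At (A₁ ++ A₂) z w M → ∃ λ j′ → At spliced z j′ D
    spliced-M⇒D oz ov≤w w< a with At-++⁻ A₁ a
    ... | inj₁ a₁ = map₂ At-prefix (restrictTo-M⇒D (o u) (o v) a₁ (before-block refl (proj₁ (first-step-bounds a₁)) oz) ov≤w)
    ... | inj₂ (z′ , w′ , a₂ , ez , ew) =
      let (z″ , e₁ , e₂) = beyond-block sumX-A₁ ez oz
          w′<r : w′ < r
          w′<r = +-cancelˡ-< (o v + k) w′ r (subst₂ _<_ (trans ew (cong (_+ w′) sumY-A₁)) (block-end≡ (o v)) w<)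
          (j′ , a′) = restrictFrom-M⇒D r r z″ a₂ e₁ w′<r
      in o v + (W + j′) , subst (λ t → At spliced t (o v + (W + j′)) D) (sym e₂) (At-suffix a′)

    sumX-spliced : r ≤ sumX A₂ → r ≤ sumY A₂ → sumX spliced ≡ sumX (A₁ ++ A₂)
    sumX-spliced r≤x r≤y = begin
      sumX (prefix ++ (replicate W M ++ suffix))          ≡⟨ sumX-++ prefix _ ⟩
      sumX prefix + sumX (replicate W M ++ suffix)        ≡⟨ cong (sumX prefix +_) (sumX-++ (replicate W M) suffix) ⟩
      sumX prefix + (sumX (replicate W M) + sumX suffix)  ≡⟨ cong₂ (λ a b → a + (b + sumX suffix)) (proj₁ sums-prefix) sumX-diagonal ⟩
      o u + (W + sumX suffix)                             ≡⟨ cong (λ t → o u + (t + sumX suffix)) W≡k+r ⟩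
      o u + (k + r + sumX suffix)                         ≡⟨ regroup (o u) k r (sumX suffix) ⟩
      o u + k + (r + sumX suffix)                         ≡⟨ cong₂ (λ a b → a + (r + b)) (sym sumX-A₁) sumX-suffix ⟩
      sumX A₁ + (r + proj₁ split-x)                       ≡⟨ cong (sumX A₁ +_) (proj₂ split-x) ⟩
      sumX A₁ + sumX A₂                                   ≡⟨ sumX-++ A₁ A₂ ⟨
      sumX (A₁ ++ A₂)                                     ∎
      where
      split-x : ∃ λ n → r + n ≡ sumX A₂
      split-x = m≤n⇒∃[o]m+o≡n r≤x
      split-y : ∃ λ n → r + n ≡ sumY A₂
      split-y = m≤n⇒∃[o]m+o≡n r≤y
      sumX-suffix : sumX suffix ≡ proj₁ split-x
      sumX-suffix = proj₁ (sums-restrictFrom r r A₂ _ _ (sym (proj₂ split-x)) (sym (proj₂ split-y)))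
      regroup : ∀ a k r z → a + (k + r + z) ≡ a + k + (r + z)
      regroup = solve-∀

    sumY-spliced : r ≤ sumX A₂ → r ≤ sumY A₂ → sumY spliced ≡ sumY (A₁ ++ A₂)
    sumY-spliced r≤x r≤y = begin
      sumY (prefix ++ (replicate W M ++ suffix))          ≡⟨ sumY-++ prefix _ ⟩
      sumY prefix + sumY (replicate W M ++ suffix)        ≡⟨ cong (sumY prefix +_) (sumY-++ (replicate W M) suffix) ⟩
      sumY prefix + (sumY (replicate W M) + sumY suffix)  ≡⟨ cong₂ (λ a b → a + (b + sumY suffix)) (proj₂ sums-prefix) sumY-diagonal ⟩
      o v + (W + sumY suffix)                             ≡⟨ cong (λ t → o v + (t + sumY suffix)) W≡k+r ⟩
      o v + (k + r + sumY suffix)                         ≡⟨ regroup (o v) k r (sumY suffix) ⟩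
      o v + k + (r + sumY suffix)                         ≡⟨ cong₂ (λ a b → a + (r + b)) (sym sumY-A₁) sumY-suffix ⟩
      sumY A₁ + (r + proj₁ split-y)                       ≡⟨ cong (sumY A₁ +_) (proj₂ split-y) ⟩
      sumY A₁ + sumY A₂                                   ≡⟨ sumY-++ A₁ A₂ ⟨
      sumY (A₁ ++ A₂)                                     ∎
      where
      split-x : ∃ λ n → r + n ≡ sumX A₂
      split-x = m≤n⇒∃[o]m+o≡n r≤x
      split-y : ∃ λ n → r + n ≡ sumY A₂
      split-y = m≤n⇒∃[o]m+o≡n r≤y
      sumY-suffix : sumY suffix ≡ proj₁ split-y
      sumY-suffix = proj₂ (sums-restrictFrom r r A₂ _ _ (sym (proj₂ split-x)) (sym (proj₂ split-y)))
      regroup : ∀ a k r z → a + (k + r + z) ≡ a + k + (r + z)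
      regroup = solve-∀

    r≤sumX-A₂ : sumX (A₁ ++ A₂) ≡ length (P F) → r ≤ sumX A₂
    r≤sumX-A₂ e = +-cancelˡ-≤ (o u + k) r (sumX A₂)
      (subst₂ _≤_ (trans suc-c-u (block-end≡ (o u)))
                  (trans (sym e) (trans (sumX-++ A₁ A₂) (cong (_+ sumX A₂) sumX-A₁)))
                  (subst (suc (c u) ≤_) (sym (length-P F)) (c<2*size u)))

    r≤sumY-A₂ : sumY (A₁ ++ A₂) ≡ length (P G) → r ≤ sumY A₂
    r≤sumY-A₂ e = +-cancelˡ-≤ (o v + k) r (sumY A₂)
      (subst₂ _≤_ (trans suc-c-v (block-end≡ (o v)))
                  (trans (sym e) (trans (sumY-++ A₁ A₂) (cong (_+ sumY A₂) sumY-A₁)))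
                  (subst (suc (c v) ≤_) (sym (length-P G)) (c<2*size v)))

    spliced-isTreeAlignment : IsTreeAlignment F G (A₁ ++ A₂) → IsTreeAlignment F G spliced
    spliced-isTreeAlignment ((sumX≡ , sumY≡) , nodes) =
      (trans (sumX-spliced r≤x r≤y) sumX≡ , trans (sumY-spliced r≤x r≤y) sumY≡) , node-condition
      where
      r≤x : r ≤ sumX A₂
      r≤x = r≤sumX-A₂ sumX≡
      r≤y : r ≤ sumY A₂
      r≤y = r≤sumY-A₂ sumY≡
      node-condition : ∀ (a : Node F) → (Deletes spliced (o a) × Deletes spliced (c a)) ⊎
        (∃ λ (b : Node G) → AlignsWith spliced (o a) (o b) × AlignsWith spliced (c a) (c b))
      node-condition a with nesting u a
      ... | descendant oa≥ ca≤ = inj₂ (b ,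
          At⇒AlignsWith (subst₂ (λ p q → At spliced p q M) (sym o-a) (sym o-b) (At-block i i<width)) ,
          At⇒AlignsWith (subst₂ (λ p q → At spliced p q M) (sym c-a) (sym c-b) (At-block j j<width)))
        where open Counterpart (counterpart a oa≥ ca≤)
      ... | unrelated oa∉ ca∉ with nodes a
      ...   | inj₁ (del-o , del-c) =
        inj₁ (At⇒Deletes (proj₂ (spliced-D (offBlockˣ oa∉) (proj₂ (Deletes⇒At del-o)))) ,
              At⇒Deletes (proj₂ (spliced-D (offBlockˣ ca∉) (proj₂ (Deletes⇒At del-c)))))
      ...   | inj₂ (b , al-o , al-c) with nesting v b
      ...     | unrelated ob∉ cb∉ =
        inj₂ (b , At⇒AlignsWith (spliced-M (offBlockˣ oa∉) (offBlockʸ ob∉) (AlignsWith⇒At al-o)) ,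
                  At⇒AlignsWith (spliced-M (offBlockˣ ca∉) (offBlockʸ cb∉) (AlignsWith⇒At al-c)))
      ...     | descendant ob≥ cb≤ =
        inj₁ (At⇒Deletes (proj₂ (spliced-M⇒D (offBlockˣ oa∉) ob≥ (<-trans (o<c b) cb<) (AlignsWith⇒At al-o))) ,
              At⇒Deletes (proj₂ (spliced-M⇒D (offBlockˣ ca∉) (≤-trans ob≥ (<⇒≤ (o<c b))) cb< (AlignsWith⇒At al-c))))
        where
        cb< : c b < o v + W
        cb< = subst (suc (c b) ≤_) suc-c-v (s≤s cb≤)

    module _ (κ : Labeling F G) (matches : Matches-counterparts κ) where

      private
        X = PlF F G κ
        Y = PlG F G κ
        cost = costFrom X Y

      cost-after-prefix : cost (sumX prefix) (sumY prefix) (replicate W M ++ suffix) ≡ cost (o u + W) (o v + W) suffix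
      cost-after-prefix = begin
        cost (sumX prefix) (sumY prefix) (replicate W M ++ suffix)
          ≡⟨ cong₂ (λ p q → cost p q (replicate W M ++ suffix)) (proj₁ sums-prefix) (proj₂ sums-prefix) ⟩
        cost (o u) (o v) (replicate W M ++ suffix)
          ≡⟨ costFrom-++ X Y (o u) (o v) (replicate W M) suffix ⟩
        cost (o u) (o v) (replicate W M) + cost (o u + sumX (replicate W M)) (o v + sumY (replicate W M)) suffix
          ≡⟨ cong₂ _+_ (costFrom-diagonal X Y (o u) (o v) W (block-agrees κ matches))
                       (cong₂ (λ p q → cost p q suffix) (cong (o u +_) sumX-diagonal) (cong (o v +_) sumY-diagonal)) ⟩
        cost (o u + W) (o v + W) suffix ∎

      ed-spliced : ed _≟Sym_ X Y spliced ≡ cost 0 0 prefix + cost (o u + W) (o v + W) suffix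
      ed-spliced = begin
        ed _≟Sym_ X Y spliced                                                ≡⟨ ed≡costFrom X Y spliced ⟩
        cost 0 0 (prefix ++ (replicate W M ++ suffix))                       ≡⟨ costFrom-++ X Y 0 0 prefix _ ⟩
        cost 0 0 prefix + cost (sumX prefix) (sumY prefix) (replicate W M ++ suffix)
                                                                             ≡⟨ cong (cost 0 0 prefix +_) cost-after-prefix ⟩
        cost 0 0 prefix + cost (o u + W) (o v + W) suffix                    ∎

      ed-original : ed _≟Sym_ X Y (A₁ ++ A₂) ≡ cost 0 0 A₁ + cost (o u + k) (o v + k) A₂
      ed-original = begin
        ed _≟Sym_ X Y (A₁ ++ A₂)                                 ≡⟨ ed≡costFrom X Y (A₁ ++ A₂) ⟩
        cost 0 0 (A₁ ++ A₂)                                      ≡⟨ costFrom-++ X Y 0 0 A₁ A₂ ⟩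
        cost 0 0 A₁ + cost (sumX A₁) (sumY A₁) A₂                ≡⟨ cong (cost 0 0 A₁ +_) (cong₂ (λ p q → cost p q A₂) sumX-A₁ sumY-A₁) ⟩
        cost 0 0 A₁ + cost (o u + k) (o v + k) A₂                ∎

      cost-prefix≤ : cost 0 0 prefix ≤ cost 0 0 A₁
      cost-prefix≤ = gap-refl (cost-restrictTo X Y (o u) (o v) A₁ 0 0 k k sumX-A₁ sumY-A₁)

      cost-suffix≤ : cost (o u + W) (o v + W) suffix ≤ cost (o u + k) (o v + k) A₂
      cost-suffix≤ = gap-refl (cost-restrictFrom X Y r r (o u + k) (o v + k) (o u + W) (o v + W) A₂ (block-end≡ (o u)) (block-end≡ (o v)))

      spliced-ed≤ : ed _≟Sym_ X Y spliced ≤ ed _≟Sym_ X Y (A₁ ++ A₂)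
      spliced-ed≤ = subst₂ _≤_ (sym ed-spliced) (sym ed-original) (+-mono-≤ cost-prefix≤ cost-suffix≤)

      spliced-ed< : cost (o u + W) (o v + W) suffix < cost (o u + k) (o v + k) A₂ → ed _≟Sym_ X Y spliced < ed _≟Sym_ X Y (A₁ ++ A₂)
      spliced-ed< suffix< = subst₂ _<_ (sym ed-spliced) (sym ed-original) (+-mono-≤-< cost-prefix≤ suffix<)

-- Finite search

alignmentsWithSums : ℕ → ℕ → List (List Step)
alignmentsWithSums zero zero = [] ∷ []
alignmentsWithSums (suc n) zero = map (D ∷_) (alignmentsWithSums n zero)
alignmentsWithSums zero (suc m) = map (I ∷_) (alignmentsWithSums zero m)
alignmentsWithSums (suc n) (suc m) =
  map (D ∷_) (alignmentsWithSums n (suc m)) ++ map (I ∷_) (alignmentsWithSums (suc n) m) ++ map (M ∷_) (alignmentsWithSums n m)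

∈-alignmentsWithSums : ∀ A → A ∈ alignmentsWithSums (sumX A) (sumY A)
∈-alignmentsWithSums [] = here refl
∈-alignmentsWithSums (D ∷ A) with sumY A | ∈-alignmentsWithSums A
... | zero | p = ∈-map⁺ (D ∷_) p
... | suc m | p = ∈-++⁺ˡ (∈-map⁺ (D ∷_) p)
∈-alignmentsWithSums (I ∷ A) with sumX A | ∈-alignmentsWithSums A
... | zero | p = ∈-map⁺ (I ∷_) p
... | suc n | p = ∈-++⁺ʳ (map (D ∷_) (alignmentsWithSums n (suc (sumY A)))) (∈-++⁺ˡ (∈-map⁺ (I ∷_) p))
∈-alignmentsWithSums (M ∷ A) =
  ∈-++⁺ʳ (map (D ∷_) (alignmentsWithSums (sumX A) (suc (sumY A))))
    (∈-++⁺ʳ (map (I ∷_) (alignmentsWithSums (suc (sumX A)) (sumY A))) (∈-map⁺ (M ∷_) (∈-alignmentsWithSums A)))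

allNodes : (fs : Forest) → List (Node fs)
allNodes [] = []
allNodes (node cs ∷ ts) = root ∷ (map below (allNodes cs) ++ map there (allNodes ts))

∈-allNodes : ∀ fs (a : Node fs) → a ∈ allNodes fs
∈-allNodes (node cs ∷ ts) root = here refl
∈-allNodes (node cs ∷ ts) (below a) = there (∈-++⁺ˡ (∈-map⁺ below (∈-allNodes cs a)))
∈-allNodes (node cs ∷ ts) (there a) = there (∈-++⁺ʳ (map below (allNodes cs)) (∈-map⁺ there (∈-allNodes ts a)))

∃-dec-by-enumeration : ∀ {B : Set} {Q : B → Set} → (∀ b → Dec (Q b)) → (l : List B) → (∀ b → b ∈ l) → Dec (∃ Q)
∃-dec-by-enumeration Q? l complete =
  map′ satisfied (λ (b , qb) → lose (complete b) qb) (any? Q? l)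

∀-dec-by-enumeration : ∀ {B : Set} {Q : B → Set} → (∀ b → Dec (Q b)) → (l : List B) → (∀ b → b ∈ l) → Dec (∀ b → Q b)
∀-dec-by-enumeration Q? l complete =
  map′ (λ all b → All.lookup all (complete b)) (λ q → All.tabulate (λ {b} _ → q b)) (all? Q? l)

_≟Step_ : DecidableEquality Step
D ≟Step D = yes refl
D ≟Step I = no (λ ())
D ≟Step M = no (λ ())
I ≟Step D = no (λ ())
I ≟Step I = yes refl
I ≟Step M = no (λ ())
M ≟Step D = no (λ ())
M ≟Step I = no (λ ())
M ≟Step M = yes refl

_≟Element_ : DecidableEquality (ℕ × ℕ × Maybe Step)
_≟Element_ = ×-≡-dec _≟_ (×-≡-dec _≟_ (MaybeP.≡-dec _≟Step_))

open import Data.List.Membership.DecPropositional _≟Element_ using (_∈?_)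

Deletes? : ∀ A x → Dec (Deletes A x)
Deletes? A x = map′ from (λ (y , mem) → lose mem (refl , refl))
  (any? (λ e → (proj₁ e ≟ x) ×-dec (MaybeP.≡-dec _≟Step_ (proj₂ (proj₂ e)) (just D))) (Elements A))
  where
  from : Any (λ e → proj₁ e ≡ x × proj₂ (proj₂ e) ≡ just D) (Elements A) → Deletes A x
  from p with find p
  ... | (_ , y , _) , mem , refl , refl = y , mem

IsTreeAlignment? : ∀ F G A → Dec (IsTreeAlignment F G A)
IsTreeAlignment? F G A =
  ((sumX A ≟ length (P F)) ×-dec (sumY A ≟ length (P G))) ×-dec
  ∀-dec-by-enumeration
    (λ u → (Deletes? A (o u) ×-dec Deletes? A (c u)) ⊎-dec
           ∃-dec-by-enumeration (λ v → ((o u , o v , just M) ∈? Elements A) ×-dec ((c u , c v , just M) ∈? Elements A))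
                                (allNodes G) (∈-allNodes G))
    (allNodes F) (∈-allNodes F)

module Minimal {B : Set} (_≺_ : B → B → Set) (_≺?_ : ∀ x y → Dec (x ≺ y))
               (≺-trans : ∀ {x y z} → x ≺ y → y ≺ z → x ≺ z) (≺-irrefl : ∀ {x} → ¬ x ≺ x)
               (Q : B → Set) (Q? : ∀ x → Dec (Q x)) where

  ≺-≼-trans : ∀ {x y z} → x ≺ y → y ≡ z ⊎ y ≺ z → x ≺ z
  ≺-≼-trans x≺y (inj₁ refl) = x≺y
  ≺-≼-trans x≺y (inj₂ y≺z) = ≺-trans x≺y y≺z

  ≼-≺-trans : ∀ {x y z} → x ≡ y ⊎ x ≺ y → y ≺ z → x ≺ z
  ≼-≺-trans (inj₁ refl) y≺z = y≺z
  ≼-≺-trans (inj₂ x≺y) y≺z = ≺-trans x≺y y≺z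

  improve : (l : List B) (m : B) → Q m → ∃ λ m′ → Q m′ × (∀ y → y ∈ l → Q y → ¬ y ≺ m′) × (m′ ≡ m ⊎ m′ ≺ m)
  improve [] m qm = m , qm , (λ _ ()) , inj₁ refl
  improve (y ∷ l) m qm with Q? y
  ... | no ¬qy =
    let (m′ , qm′ , minimal , m′≼m) = improve l m qm
    in m′ , qm′ , (λ { z (here refl) qz _ → ¬qy qz ; z (there z∈l) qz → minimal z z∈l qz }) , m′≼m
  ... | yes qy with y ≺? m
  ...   | yes y≺m =
    let (m′ , qm′ , minimal , m′≼y) = improve l y qy
    in m′ , qm′ , (λ { z (here refl) _ z≺m′ → ≺-irrefl (≺-≼-trans z≺m′ m′≼y) ; z (there z∈l) qz → minimal z z∈l qz }) ,
       inj₂ (≼-≺-trans m′≼y y≺m)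
  ...   | no y⊀m =
    let (m′ , qm′ , minimal , m′≼m) = improve l m qm
    in m′ , qm′ , (λ { z (here refl) _ z≺m′ → y⊀m (≺-≼-trans z≺m′ m′≼m) ; z (there z∈l) qz → minimal z z∈l qz }) , m′≼m

  minimal : (l : List B) (b₀ : B) → Q b₀ → ∃ λ m → Q m × (∀ y → y ∈ l → Q y → ¬ y ≺ m)
  minimal l b₀ qb₀ = let (m , qm , min , _) = improve l b₀ qb₀ in m , qm , min

-- The order on tree alignments and its minima

isIndel : Step → Bool
isIndel D = true
isIndel I = true
isIndel M = false

_<ᴸ_ : List Bool → List Bool → Set
_<ᴸ_ = Lex-< _≡_ Bool._<_

matchFirst-<ᴸ : ∀ A₁ {R R′ s} → s ≢ M → map isIndel (A₁ ++ M ∷ R′) <ᴸ map isIndel (A₁ ++ s ∷ R)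
matchFirst-<ᴸ [] {s = D} _ = this Bool.f<t
matchFirst-<ᴸ [] {s = I} _ = this Bool.f<t
matchFirst-<ᴸ [] {s = M} s≢M = ⊥-elim (s≢M refl)
matchFirst-<ᴸ (t ∷ A₁) s≢M = next refl (matchFirst-<ᴸ A₁ s≢M)

module AlignmentOrder (cost₁ cost₂ : List Step → ℕ) where

  _<ᵏ_ : ℕ × ℕ × List Bool → ℕ × ℕ × List Bool → Set
  _<ᵏ_ = ×-Lex _≡_ _<_ (×-Lex _≡_ _<_ _<ᴸ_)

  <ᵏ-isStrictPartialOrder : IsStrictPartialOrder _ _<ᵏ_
  <ᵏ-isStrictPartialOrder = ×-isStrictPartialOrder <-isStrictPartialOrder
    (×-isStrictPartialOrder <-isStrictPartialOrder (Lex-<-isStrictPartialOrder BoolP.<-isStrictPartialOrder))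

  open IsStrictPartialOrder <ᵏ-isStrictPartialOrder using (irrefl) renaming (trans to <ᵏ-trans; module Eq to Eqᵏ)

  key : List Step → ℕ × ℕ × List Bool
  key A = cost₁ A , cost₂ A , map isIndel A

  _≺_ : List Step → List Step → Set
  A ≺ B = key A <ᵏ key B

  _≺?_ : ∀ A B → Dec (A ≺ B)
  A ≺? B = ×-decidable _≟_ _<?_ (×-decidable _≟_ _<?_ (Lex-<-decidable BoolP._≟_ BoolP._<?_)) (key A) (key B)

  ≺-trans : ∀ {A B C} → A ≺ B → B ≺ C → A ≺ C
  ≺-trans = <ᵏ-trans

  ≺-irrefl : ∀ {A} → ¬ A ≺ A
  ≺-irrefl = irrefl Eqᵏ.refl

  ≺-by-cost₂ : ∀ {A B} → cost₁ A ≤ cost₁ B → cost₂ A < cost₂ B → A ≺ B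
  ≺-by-cost₂ c₁≤ c₂< with m≤n⇒m<n∨m≡n c₁≤
  ... | inj₁ c₁< = inj₁ c₁<
  ... | inj₂ c₁≡ = inj₂ (c₁≡ , inj₁ c₂<)

  ≺-by-indels : ∀ {A B} → cost₁ A ≤ cost₁ B → cost₂ A ≤ cost₂ B → map isIndel A <ᴸ map isIndel B → A ≺ B
  ≺-by-indels c₁≤ c₂≤ l< with m≤n⇒m<n∨m≡n c₁≤ | m≤n⇒m<n∨m≡n c₂≤
  ... | inj₁ c₁< | _ = inj₁ c₁<
  ... | inj₂ c₁≡ | inj₁ c₂< = inj₂ (c₁≡ , inj₁ c₂<)
  ... | inj₂ c₁≡ | inj₂ c₂≡ = inj₂ (c₁≡ , inj₂ (c₂≡ , l<))

module Optimum (F G : Forest) (h : ℕ) (lab lab^ : Labeling F G) (hF : height F ≤ h) (hG : height G ≤ h)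
               (look-ahead : IsLookAhead F G lab h lab^) where

  X Y X̂ Ŷ : List Sym
  X = PlF F G lab
  Y = PlG F G lab
  X̂ = PlF F G lab^
  Ŷ = PlG F G lab^

  open AlignmentOrder (ed _≟Sym_ X Y) (ed _≟Sym_ X̂ Ŷ) public

  Improvable : List Step → Set
  Improvable A = ∃ λ B → IsTreeAlignment F G B × B ≺ A

  module _ (u : Node F) (v : Node G) (u≈v : lab^ (inj₁ u) ≡ lab^ (inj₂ v)) where

    open Splice F G lab lab^ h hF hG look-ahead u v u≈v

    opening-improvable : ∀ A₁ {s} A₂ → s ≢ M → sumX A₁ ≡ o u → sumY A₁ ≡ o v →
      IsTreeAlignment F G (A₁ ++ s ∷ A₂) → Improvable (A₁ ++ s ∷ A₂)
    opening-improvable A₁ {s} A₂ s≢M sx sy ta =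
      spliced , spliced-isTreeAlignment ta , ≺-by-indels (spliced-ed≤ lab lab-matches) (spliced-ed≤ lab^ lab^-matches) indels<
      where
      open Spliced A₁ (s ∷ A₂) 0 W refl (trans sx (sym (+-identityʳ _))) (trans sy (sym (+-identityʳ _)))
      spliced≡ : spliced ≡ A₁ ++ M ∷ (replicate (pred W) M ++ suffix)
      spliced≡ = cong₂ _++_ (restrictTo-exact (o u) (o v) A₁ sx sy) (cong (λ n → replicate n M ++ suffix) (width≡suc u))
      indels< : map isIndel spliced <ᴸ map isIndel (A₁ ++ s ∷ A₂)
      indels< = subst (λ S → map isIndel S <ᴸ map isIndel (A₁ ++ s ∷ A₂)) (sym spliced≡) (matchFirst-<ᴸ A₁ s≢M)

    no-match-in-column : ∀ A₁ A₂ → sumX A₁ ≡ c u → sumY A₁ ≡ c v → IsTreeAlignment F G (A₁ ++ D ∷ A₂) →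
      ∀ {z} → At (A₁ ++ D ∷ A₂) z (c v) M → c u < z → X̂ ! z ≢ Ŷ ! c v
    no-match-in-column A₁ A₂ sx sy (_ , nodes) {z} z↦cv cu<z eq
      with Pl-!-just F (lab^ ∘ inj₁) z (trans eq (Pl-!-c G (lab^ ∘ inj₂) v))
    ... | a , _ , inj₁ (_ , ())
    ... | a , v≈a , inj₂ (refl , _) with nodes a
    ...   | inj₁ (_ , del-c) with At-uniqueˣ (proj₂ (Deletes⇒At del-c)) z↦cv refl refl
    ...     | _ , ()
    no-match-in-column A₁ A₂ sx sy (_ , nodes) {z} z↦cv cu<z eq
        | a , v≈a , inj₂ (refl , _) | inj₂ (b , al-o , al-c) = nested (laminar a u)
      where
      b≡v : b ≡ v
      b≡v = c-injective (proj₁ (At-uniqueˣ (AlignsWith⇒At al-c) z↦cv refl refl))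
      oa↦ov : At (A₁ ++ D ∷ A₂) (o a) (o v) M
      oa↦ov = subst (λ t → At _ (o a) (o t) M) b≡v (AlignsWith⇒At al-o)
      deletion : At (A₁ ++ D ∷ A₂) (c u) (c v) D
      deletion = subst₂ (λ p q → At _ p q D) sx sy (At-middle A₁ D A₂)
      oa<cu : o a < c u
      oa<cu with At-ordered oa↦ov deletion
      ... | same-step _ _ ()
      ... | earlier-step p _ = subst (_≤ c u) (+-comm (o a) 1) p
      ... | later-step _ p = ⊥-elim (<⇒≱ (o<c v) (subst (_≤ o v) (+-identityʳ _) p))
      nested : Laminar a u → ⊥
      nested (same refl) = <-irrefl refl cu<z
      nested (inside _ ca<cu) = <-asym ca<cu cu<z
      nested (outside oa<ou cu<ca) = equal-PlSub-not-nested h (lab ∘ inj₁) hF a u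
        (Equivalence.to (look-ahead (inj₁ a) (inj₁ u)) (trans (sym v≈a) (sym u≈v))) oa<ou cu<ca
      nested (before ca<ou) = <-asym (<-trans (o<c u) cu<z) ca<ou
      nested (after cu<oa) = <-asym cu<oa oa<cu

    no-match-in-row : ∀ A₁ A₂ → sumX A₁ ≡ c u → sumY A₁ ≡ c v → IsTreeAlignment F G (A₁ ++ I ∷ A₂) →
      ∀ {w} → At (A₁ ++ I ∷ A₂) (c u) w M → c v < w → X̂ ! c u ≢ Ŷ ! w
    no-match-in-row A₁ A₂ sx sy (_ , nodes) {w} cu↦w cv<w eq
      with Pl-!-just G (lab^ ∘ inj₂) w (trans (sym eq) (Pl-!-c F (lab^ ∘ inj₁) u))
    ... | b , _ , inj₁ (_ , ())
    ... | b , u≈b , inj₂ (refl , _) with nodes u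
    ...   | inj₁ (_ , del-c) with At-uniqueˣ (proj₂ (Deletes⇒At del-c)) cu↦w refl refl
    ...     | _ , ()
    no-match-in-row A₁ A₂ sx sy (_ , nodes) {w} cu↦w cv<w eq
        | b , u≈b , inj₂ (refl , _) | inj₂ (b′ , al-o , al-c) = nested (laminar b v)
      where
      b′≡b : b′ ≡ b
      b′≡b = c-injective (sym (proj₁ (At-uniqueˣ cu↦w (AlignsWith⇒At al-c) refl refl)))
      ou↦ob : At (A₁ ++ I ∷ A₂) (o u) (o b) M
      ou↦ob = subst (λ t → At _ (o u) (o t) M) b′≡b (AlignsWith⇒At al-o)
      insertion : At (A₁ ++ I ∷ A₂) (c u) (c v) I
      insertion = subst₂ (λ p q → At _ p q I) sx sy (At-middle A₁ I A₂)
      ob<cv : o b < c v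
      ob<cv with At-ordered ou↦ob insertion
      ... | same-step _ _ ()
      ... | earlier-step _ p = subst (_≤ c v) (+-comm (o b) 1) p
      ... | later-step p _ = ⊥-elim (<⇒≱ (o<c u) (subst (_≤ o u) (+-identityʳ _) p))
      nested : Laminar b v → ⊥
      nested (same refl) = <-irrefl refl cv<w
      nested (inside _ cb<cv) = <-asym cb<cv cv<w
      nested (outside ob<ov cv<cb) = equal-PlSub-not-nested h (lab ∘ inj₂) hG b v
        (Equivalence.to (look-ahead (inj₂ b) (inj₂ v)) (trans (sym u≈b) u≈v)) ob<ov cv<cb
      nested (before cb<ov) = <-asym (<-trans (o<c v) cv<w) cb<ov
      nested (after cv<ob) = <-asym cv<ob ob<cv

    module Closing (A₁ : List Step) (s : Step) (A₂ : List Step) (sx : sumX A₁ ≡ c u) (sy : sumY A₁ ≡ c v) where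

      k : ℕ
      k = pred W

      W≡k+1 : W ≡ k + 1
      W≡k+1 = trans (width≡suc u) (+-comm 1 k)

      cu≡ : c u ≡ o u + k
      cu≡ = suc-injective (trans suc-c-u (trans (cong (o u +_) (width≡suc u)) (+-suc (o u) k)))

      cv≡ : c v ≡ o v + k
      cv≡ = suc-injective (trans suc-c-v (trans (cong (o v +_) (width≡suc u)) (+-suc (o v) k)))

      open Spliced A₁ (s ∷ A₂) k 1 W≡k+1 (trans sx cu≡) (trans sy cv≡) public

      improvable : costFrom X̂ Ŷ (o u + W) (o v + W) suffix < costFrom X̂ Ŷ (o u + k) (o v + k) (s ∷ A₂) →
        IsTreeAlignment F G (A₁ ++ s ∷ A₂) → Improvable (A₁ ++ s ∷ A₂)
      improvable suffix< ta =
        spliced , spliced-isTreeAlignment ta , ≺-by-cost₂ (spliced-ed≤ lab lab-matches) (spliced-ed< lab^ lab^-matches suffix<)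

      shift-end : ∀ x₀ → x₀ + k + 1 ≡ x₀ + W
      shift-end x₀ = trans (+-assoc x₀ k 1) (cong (x₀ +_) (sym W≡k+1))

    closing-deletion-improvable : ∀ A₁ A₂ → sumX A₁ ≡ c u → sumY A₁ ≡ c v →
      IsTreeAlignment F G (A₁ ++ D ∷ A₂) → Improvable (A₁ ++ D ∷ A₂)
    closing-deletion-improvable A₁ A₂ sx sy ta = improvable (s≤s suffix≤) ta
      where
      open Closing A₁ D A₂ sx sy
      unmatched : ∀ i → At A₂ i 0 M → X̂ ! (o u + k + 1 + i) ≢ Ŷ ! (o v + k + 0)
      unmatched i i↦0 eq = no-match-in-column A₁ A₂ sx sy ta
        (subst (λ t → At (A₁ ++ D ∷ A₂) (sumX A₁ + suc i) t M) (trans (+-identityʳ _) sy) (At-++ʳ A₁ (later i↦0)))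
        (subst (_< sumX A₁ + suc i) sx (m<m+n (sumX A₁) (s≤s z≤n)))
        (subst₂ (λ p q → X̂ ! p ≡ Ŷ ! q)
          (trans (+-assoc (o u + k) 1 i) (cong (_+ suc i) (sym (trans sx cu≡))))
          (trans (+-identityʳ _) (sym cv≡)) eq)
      suffix≤ : costFrom X̂ Ŷ (o u + W) (o v + W) (restrictFrom 0 1 A₂) ≤ costFrom X̂ Ŷ (o u + k + 1) (o v + k + 0) A₂
      suffix≤ = subst (λ p → costFrom X̂ Ŷ p (o v + W) (restrictFrom 0 1 A₂) ≤ costFrom X̂ Ŷ (o u + k + 1) (o v + k + 0) A₂)
        (shift-end (o u))
        (cost-restrictFrom-0-1 X̂ Ŷ A₂ (o u + k + 1) (o v + k + 0) (o v + W)
          (trans (sym (shift-end (o v))) (cong (_+ 1) (sym (+-identityʳ _)))) unmatched)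

    closing-insertion-improvable : ∀ A₁ A₂ → sumX A₁ ≡ c u → sumY A₁ ≡ c v →
      IsTreeAlignment F G (A₁ ++ I ∷ A₂) → Improvable (A₁ ++ I ∷ A₂)
    closing-insertion-improvable A₁ A₂ sx sy ta = improvable (s≤s suffix≤) ta
      where
      open Closing A₁ I A₂ sx sy
      unmatched : ∀ j → At A₂ 0 j M → X̂ ! (o u + k + 0) ≢ Ŷ ! (o v + k + 1 + j)
      unmatched j 0↦j eq = no-match-in-row A₁ A₂ sx sy ta
        (subst (λ t → At (A₁ ++ I ∷ A₂) t (sumY A₁ + suc j) M) (trans (+-identityʳ _) sx) (At-++ʳ A₁ (later 0↦j)))
        (subst (_< sumY A₁ + suc j) sy (m<m+n (sumY A₁) (s≤s z≤n)))
        (subst₂ (λ p q → X̂ ! p ≡ Ŷ ! q)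
          (trans (+-identityʳ _) (sym cu≡))
          (trans (+-assoc (o v + k) 1 j) (cong (_+ suc j) (sym (trans sy cv≡)))) eq)
      suffix≤ : costFrom X̂ Ŷ (o u + W) (o v + W) (restrictFrom 1 0 A₂) ≤ costFrom X̂ Ŷ (o u + k + 0) (o v + k + 1) A₂
      suffix≤ = subst (λ q → costFrom X̂ Ŷ (o u + W) q (restrictFrom 1 0 A₂) ≤ costFrom X̂ Ŷ (o u + k + 0) (o v + k + 1) A₂)
        (shift-end (o v))
        (cost-restrictFrom-1-0 X̂ Ŷ A₂ (o u + k + 0) (o v + k + 1) (o u + W)
          (trans (sym (shift-end (o u))) (cong (_+ 1) (sym (+-identityʳ _)))) unmatched)

  breakpoint-improvable : ∀ A₁ s A₂ → IsTreeAlignment F G (A₁ ++ s ∷ A₂) → s ≢ M →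
    ∀ {e} → X̂ ! sumX A₁ ≡ just e → Ŷ ! sumY A₁ ≡ just e → Improvable (A₁ ++ s ∷ A₂)
  breakpoint-improvable A₁ s A₂ ta s≢M ex ey with Pl-!-matching⁻¹ lab^ (sumX A₁) (sumY A₁) ex ey
  ... | a , b , a≈b , inj₁ (oa≡ , ob≡) = opening-improvable a b a≈b A₁ A₂ s≢M (sym oa≡) (sym ob≡) ta
  ... | a , b , a≈b , inj₂ (ca≡ , cb≡) with s
  ...   | D = closing-deletion-improvable a b a≈b A₁ A₂ (sym ca≡) (sym cb≡) ta
  ...   | I = closing-insertion-improvable a b a≈b A₁ A₂ (sym ca≡) (sym cb≡) ta
  ...   | M = ⊥-elim (s≢M refl)

  length-X̂ : length X̂ ≡ length (P F)
  length-X̂ = trans (length-Pl F (lab^ ∘ inj₁)) (sym (length-P F))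

  length-Ŷ : length Ŷ ≡ length (P G)
  length-Ŷ = trans (length-Pl G (lab^ ∘ inj₂)) (sym (length-P G))

  breakpoint-mismatch : ∀ A → IsTreeAlignment F G A → ¬ Improvable A → ∀ {x y s} → At A x y s → s ≢ M →
    x ≢ length X̂ → X̂ ! x ≢ Ŷ ! y
  breakpoint-mismatch A ta@((sumX≡ , _) , _) ¬imp {s = s} step s≢M x≢ eq with At-split step
  ... | A₁ , A₂ , refl , refl , refl =
    let x≤ = ≤-trans (m≤m+n (sumX A₁) (dx s)) (proj₁ (At-bounded step))
        (e , ex) = <⇒!≡just X̂ (sumX A₁) (≤∧≢⇒< (subst (sumX A₁ ≤_) (trans sumX≡ (sym length-X̂)) x≤) x≢)
    in ¬imp (breakpoint-improvable A₁ s A₂ ta s≢M ex (trans (sym eq) ex))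

  unimprovable⇒greedy : ∀ A → IsTreeAlignment F G A → ¬ Improvable A → Greedy X̂ Ŷ A
  unimprovable⇒greedy A ((sumX≡ , _) , _) _ x y nothing mem _ x≢ _ _ =
    x≢ (trans (proj₁ (trace-end A 0 0 mem)) (trans sumX≡ (sym length-X̂)))
  unimprovable⇒greedy A ta ¬imp x y (just s) mem ¬match x≢ _ eq with trace⇒At A 0 0 mem
  ... | _ , _ , step , refl , refl with s
  ...   | M = ¬match (refl , eq)
  ...   | D = breakpoint-mismatch A ta ¬imp step (λ ()) x≢ eq
  ...   | I = breakpoint-mismatch A ta ¬imp step (λ ()) x≢ eq

  tree-alignment⇒alignment : ∀ {A} → IsTreeAlignment F G A → IsAlignment X̂ Ŷ A
  tree-alignment⇒alignment ((sumX≡ , sumY≡) , _) = trans sumX≡ (sym length-X̂) , trans sumY≡ (sym length-Ŷ)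

  unimprovable⇒optimal : ∀ {A B} → ¬ Improvable A → IsTreeAlignment F G B → ed _≟Sym_ X Y A ≤ ed _≟Sym_ X Y B
  unimprovable⇒optimal ¬imp tb = ≮⇒≥ (λ B<A → ¬imp (_ , tb , inj₁ B<A))

  deleteThenInsert : List Step
  deleteThenInsert = replicate (length (P F)) D ++ replicate (length (P G)) I

  deleteThenInsert-isTreeAlignment : IsTreeAlignment F G deleteThenInsert
  deleteThenInsert-isTreeAlignment = (sumX≡ , sumY≡) , λ a → inj₁ (deleted (o<2*size a) , deleted (c<2*size a))
    where
    nF nG : ℕ
    nF = length (P F)
    nG = length (P G)
    sumX≡ : sumX deleteThenInsert ≡ nF
    sumX≡ = begin
      sumX (replicate nF D ++ replicate nG I)           ≡⟨ sumX-++ (replicate nF D) _ ⟩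
      sumX (replicate nF D) + sumX (replicate nG I)     ≡⟨ cong₂ _+_ (sumX-replicate nF D) (sumX-replicate nG I) ⟩
      nF * 1 + nG * 0                                   ≡⟨ cong₂ _+_ (*-identityʳ nF) (*-zeroʳ nG) ⟩
      nF + 0                                            ≡⟨ +-identityʳ nF ⟩
      nF                                                ∎
    sumY≡ : sumY deleteThenInsert ≡ nG
    sumY≡ = begin
      sumY (replicate nF D ++ replicate nG I)           ≡⟨ sumY-++ (replicate nF D) _ ⟩
      sumY (replicate nF D) + sumY (replicate nG I)     ≡⟨ cong₂ _+_ (sumY-replicate nF D) (sumY-replicate nG I) ⟩
      nF * 0 + nG * 1                                   ≡⟨ cong₂ _+_ (*-zeroʳ nF) (*-identityʳ nG) ⟩
      nG                                                ∎
    deleted : ∀ {x} → x < 2 * size F → Deletes deleteThenInsert x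
    deleted {x} x< = At⇒Deletes (At-++ˡ (replicate nG I) (At-replicate-D nF x (subst (x <_) (sym (length-P F)) x<)))

  candidates : List (List Step)
  candidates = alignmentsWithSums (length (P F)) (length (P G))

  ∈-candidates : ∀ {B} → IsTreeAlignment F G B → B ∈ candidates
  ∈-candidates {B} ((sumX≡ , sumY≡) , _) = subst₂ (λ p q → B ∈ alignmentsWithSums p q) sumX≡ sumY≡ (∈-alignmentsWithSums B)

  open Minimal _≺_ _≺?_ ≺-trans ≺-irrefl (IsTreeAlignment F G) (IsTreeAlignment? F G)

  unimprovable-tree-alignment : ∃ λ A → IsTreeAlignment F G A × ¬ Improvable A
  unimprovable-tree-alignment with minimal candidates deleteThenInsert deleteThenInsert-isTreeAlignment
  ... | A , ta , minimal-A = A , ta , λ (B , tb , B≺A) → minimal-A B (∈-candidates tb) tb B≺A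

halve-mono : ∀ {m n} → m ≤ n → (ℤ.+ m) / 2 Q.≤ (ℤ.+ n) / 2
halve-mono {m} {n} m≤n = *≤* (subst₂ ℤ._≤_ (ℤP.pos-* m 2) (ℤP.pos-* n 2) (ℤ.+≤+ (*-monoˡ-≤ 2 m≤n)))

proposition4p4 : (F G : Forest) (h : ℕ) (lab lab^ : Labeling F G) →
    height F ≤ h → height G ≤ h → IsLookAhead F G lab h lab^ →
    Σ (List Step) λ A →
      IsTreeAlignment F G A ×
      (∀ B → IsTreeAlignment F G B → ted F G lab A Q.≤ ted F G lab B) ×
      IsAlignment (PlF F G lab^) (PlG F G lab^) A ×
      Greedy (PlF F G lab^) (PlG F G lab^) A
proposition4p4 F G h lab lab^ hF hG look-ahead with Optimum.unimprovable-tree-alignment F G h lab lab^ hF hG look-ahead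
... | A , ta , ¬improvable =
  A , ta , (λ B tb → halve-mono (unimprovable⇒optimal ¬improvable tb)) ,
  tree-alignment⇒alignment ta , unimprovable⇒greedy A ta ¬improvable
  where open Optimum F G h lab lab^ hF hG look-ahead
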